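{- Let $G$ be a circuit in some $2$-rigidity matroid, and suppose there are vertices $u,w\in V(G)$ and subgraphs $X,Y\subseteq G$ with $|X|\ge2$, $|Y|\ge2$, such that $X$ and $Y$ partition the edge set of $G$ and $V(X)\cap V(Y)=\{u,w\}$. Then $e=\{u,w\}$ is not an edge of $G$, and both $X+e$ and $Y+e$ are circuits of that matroid.
   Context: Graphs are identified with their edge sets; $|X|$ is the number of edges. A $2$-rigidity matroid is a matroid on $\binom{[n]}{2}$ of rank $2n-3$ in which every copy of $K_4$ is a circuit. $X+e$ denotes $X$ with the edge $e$ added. -}

module Defs where

open import Data.Nat using (ℕ; _+_; _*_; _≤_; _<_)
open import Data.Fin using (Fin) renaming (_<_ to _<F_)
open import Data.Fin.Properties using (_≟_; <-cmp)
open import Data.Bool using (Bool; true; false; _∧_; _∨_; not)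
open import Data.List using (List; []; _∷_; filter; length; concatMap)
open import Data.List using (allFin)
open import Data.Product using (Σ; ∃; _×_; _,_)
open import Data.Sum using (_⊎_)
open import Relation.Binary.PropositionalEquality using (_≡_; _≢_; sym)
open import Relation.Nullary using (¬_; yes; no; does)
open import Relation.Binary.Definitions using (tri<; tri≈; tri>)
open import Data.Empty using (⊥-elim)
open import Data.Maybe using (Maybe; just; nothing)

-- An edge of K_n on vertex set Fin n: an unordered pair {lo, hi}, stored with lo < hi.
record Edge (n : ℕ) : Set where
  constructor edge
  field
    lo hi : Fin n
    lo<hi : lo <F hi
open Edge public

-- A graph on [n] is identified with its edge set (a decidable subset of the edges of K_n).
EdgeSet : ℕ → Set
EdgeSet n = Edge n → Bool

mkEdge : ∀ {n} (u w : Fin n) → u ≢ w → Edge n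
mkEdge u w u≢w with <-cmp u w
... | tri< u<w _ _ = edge u w u<w
... | tri≈ _ u≡w _ = ⊥-elim (u≢w u≡w)
... | tri> _ _ w<u = edge w u w<u

_==E_ : ∀ {n} → Edge n → Edge n → Bool
f ==E e = does (lo f ≟ lo e) ∧ does (hi f ≟ hi e)

allEdges : (n : ℕ) → List (Edge n)
allEdges n = concatMap (λ i → concatMap (λ j → pick i j) (allFin n)) (allFin n)
  where
  pick : Fin n → Fin n → List (Edge n)
  pick i j with <-cmp i j
  ... | tri< i<j _ _ = edge i j i<j ∷ []
  ... | tri≈ _ _ _ = []
  ... | tri> _ _ _ = []

card : ∀ {n} → EdgeSet n → ℕ
card {n} X = length (filter (λ e → X e ≡? true) (allEdges n))
  where
  open import Data.Bool.Properties using () renaming (_≟_ to _≡?_)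

_∈E_ : ∀ {n} → Edge n → EdgeSet n → Set
e ∈E X = X e ≡ true

_⊆E_ : ∀ {n} → EdgeSet n → EdgeSet n → Set
X ⊆E Y = ∀ e → e ∈E X → e ∈E Y

_+E_ : ∀ {n} → EdgeSet n → Edge n → EdgeSet n
(X +E e) f = X f ∨ (f ==E e)

_-E_ : ∀ {n} → EdgeSet n → Edge n → EdgeSet n
(X -E e) f = X f ∧ not (f ==E e)

∅E : ∀ {n} → EdgeSet n
∅E _ = false

_∈V_ : ∀ {n} → Fin n → EdgeSet n → Set
v ∈V X = ∃ λ e → e ∈E X × (lo e ≡ v ⊎ hi e ≡ v)

record Matroid (n : ℕ) : Set₁ where
  field
    Indep     : EdgeSet n → Set
    indep-∅   : Indep ∅E
    indep-⊆   : ∀ {I J} → Indep J → I ⊆E J → Indep I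
    augment   : ∀ {I J} → Indep I → Indep J → card I < card J →
                ∃ λ e → e ∈E J × I e ≡ false × Indep (I +E e)

  Circuit : EdgeSet n → Set
  Circuit C = ¬ Indep C × (∀ e → e ∈E C → Indep (C -E e))

  HasRank : ℕ → Set
  HasRank r = (∃ λ I → Indep I × card I ≡ r) × (∀ I → Indep I → card I ≤ r)

K4 : ∀ {n} → Fin n → Fin n → Fin n → Fin n → EdgeSet n
K4 a b c d e = inS (lo e) ∧ inS (hi e)
  where
  inS : _ → Bool
  inS v = does (v ≟ a) ∨ does (v ≟ b) ∨ does (v ≟ c) ∨ does (v ≟ d)

-- A 2-rigidity matroid on binom([n],2): rank 2n - 3 (written rank + 3 = 2n),
-- and every copy of K_4 is a circuit.
record RigidityMatroid2 (n : ℕ) : Set₁ where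
  field
    matroid : Matroid n
  open Matroid matroid public
  field
    rank    : ∃ λ r → HasRank r × r + 3 ≡ 2 * n
    K4-circ : ∀ a b c d → a ≢ b → a ≢ c → a ≢ d → b ≢ c → b ≢ d → c ≢ d →
              Circuit (K4 a b c d)

{-# OPTIONS --safe #-}
-- Write e = uw.  The vertex sets W₂ = V(Y) ∪ {u, w} and W₁ = (V ∖ V(Y)) ∪ {u, w} cover V and
-- meet in {u, w}, so |W₁| + |W₂| ≤ n + 2.  Since copies of K4 are circuits, K[U] is spanned by
-- K[U − v] together with vu and vw (any other edge vc closes a K4 on v, c, u, w), so independent
-- subsets of K[U] have at most 2|U| − 3 edges.  Hence independent sets I ⊆ K[W₁] and J ⊆ K[W₂]
-- sharing an edge have independent union: extend them to bases B₁, B₂; a basis of B₁ ∪ B₂ spans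
-- every edge (an edge across the separation closes a K4 with u and w), so it has at least 2n − 3
-- edges, while |B₁ ∪ B₂| ≤ (2|W₁| − 3) + (2|W₂| − 3) − 1 ≤ 2n − 3.
-- If e ∈ X, then Y + e lies in G − x for some x ∈ X, so it is independent, and gluing it with X
-- makes G independent; so e ∉ X.  If X + e were independent, gluing it with Y + e would make G
-- independent, and gluing it with an independent set of size |Y| in Y + e containing e gives an
-- independent set of size |G| in G + e, which by circuit exchange makes Y + e independent after
-- all.  For f ∈ X, an independent set of size |G| − 1 in {e} ∪ (G − f) containing e (here {e} is
-- independent, lying in a K4 with a vertex of X and one of Y outside {u, w}) misses at most one
-- edge, and that edge is not in X since Y + e is dependent; so X + e − f is independent.
-- Independence is not decidable, but there are finitely many edge sets, so it is decidable under
-- double negation; that suffices to build bases in the proofs of the negative statements.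
module Submission where

open import Defs
open import Data.Nat using (ℕ; zero; suc; _+_; _*_; _≤_; _<_; z≤n; s≤s; s≤s⁻¹; _≤?_)
open import Data.Nat.Properties
  using (≤-refl; ≤-trans; ≤-reflexive; <-≤-trans; ≰⇒>; 1+n≰n; m≤m+n; m≤n+m; +-comm; +-assoc; +-suc;
         +-identityʳ; +-mono-≤; +-mono-≤-<; +-monoˡ-≤; +-monoʳ-≤; +-cancelʳ-≤; *-suc; *-distribˡ-+; *-monoʳ-≤;
         +-commutativeSemigroup; module ≤-Reasoning)
open import Data.Fin using (Fin) renaming (_<_ to _<F_)
open import Data.Fin.Properties using (<-irrelevant; <-irrefl; <-asym; <-cmp; any?) renaming (_≟_ to _≟F_)
open import Data.Bool using (Bool; true; false; _∧_; _∨_; not)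
open import Data.Bool.Properties using (∨-comm; ∧-comm; not-¬) renaming (_≟_ to _≟B_)
open import Data.List using (List; []; _∷_; length; filter; concatMap; allFin)
open import Data.List.Properties using (length-filter; length-tabulate)
open import Data.List.Membership.Propositional using (_∈_; lose)
open import Data.List.Membership.Propositional.Properties
  using (∈-concatMap⁺; ∈-concatMap⁻; ∈-allFin; ∈-filter⁻)
open import Data.List.Relation.Unary.Any using (here; there; satisfied)
open import Data.List.Relation.Unary.All using ([]; _∷_)
open import Data.List.Relation.Unary.All.Properties using (All¬⇒¬Any)
open import Data.List.Relation.Binary.Disjoint.Propositional using (Disjoint)
import Data.List.Relation.Unary.Any as Any
open import Data.List.Relation.Unary.Unique.Propositional using (Unique; []; _∷_)
open import Data.List.Relation.Unary.Unique.Propositional.Properties using (allFin⁺; ++⁺; filter⁺)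
open import Data.Product using (Σ; ∃; _×_; _,_; proj₁; proj₂; swap; uncurry)
open import Data.Sum using (_⊎_; inj₁; inj₂; map₂; [_,_]′)
open import Data.Empty using (⊥-elim)
open import Function using (_∘_; id)
open import Function.Bundles using (_⇔_; Equivalence)
open import Relation.Nullary using (¬_; Dec; yes; no; does; contradiction)
open import Relation.Nullary.Decidable using (dec-true; dec-false; map′; ¬¬-excluded-middle; _×-dec_; _⊎-dec_; ¬?)
open import Relation.Nullary.Negation using (¬¬-map; ¬¬-Monad)
open import Effect.Monad using (RawMonad)
open import Data.Vec using (Vec; []; _∷_)
open import Relation.Binary.PropositionalEquality hiding (J)
open import Relation.Binary.Definitions using (tri<; tri≈; tri>)
open import Algebra.Properties.CommutativeSemigroup +-commutativeSemigroup using (interchange)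

private
  variable
    n : ℕ
    B B₁ B₂ C P Q S T I J : EdgeSet n
    e f g : Edge n
    a b c d u v w x y : Fin n

∨-true⁻ : ∀ {a b} → a ∨ b ≡ true → a ≡ true ⊎ b ≡ true
∨-true⁻ {true} _ = inj₁ refl
∨-true⁻ {false} b≡true = inj₂ b≡true

∨-trueˡ : ∀ {a} b → a ≡ true → a ∨ b ≡ true
∨-trueˡ b refl = refl

∨-trueʳ : ∀ a {b} → b ≡ true → a ∨ b ≡ true
∨-trueʳ true _ = refl
∨-trueʳ false b≡true = b≡true

∧-true⁻ : ∀ {a b} → a ∧ b ≡ true → a ≡ true × b ≡ true
∧-true⁻ {true} {true} _ = refl , refl

∧-true⁺ : ∀ {a b} → a ≡ true → b ≡ true → a ∧ b ≡ true
∧-true⁺ refl refl = refl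

does-true⁻ : ∀ {P : Set} (P? : Dec P) → does P? ≡ true → P
does-true⁻ (yes p) _ = p

-- Counting

iverson : Bool → ℕ
iverson true = 1
iverson false = 0

count : {A : Set} → (A → Bool) → List A → ℕ
count p xs = length (filter (λ x → p x ≟B true) xs)

iverson-mono : ∀ {a b} → (a ≡ true → b ≡ true) → iverson a ≤ iverson b
iverson-mono {false} _ = z≤n
iverson-mono {true} a⇒b rewrite a⇒b refl = ≤-refl

module _ {A : Set} where

  count-∷ : ∀ (p : A → Bool) x xs → count p (x ∷ xs) ≡ iverson (p x) + count p xs
  count-∷ p x xs with p x
  ... | true = refl
  ... | false = refl

  count-mono : ∀ {p q : A → Bool} → (∀ x → p x ≡ true → q x ≡ true) → ∀ xs → count p xs ≤ count q xs
  count-mono p⊆q [] = z≤n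
  count-mono {p} {q} p⊆q (x ∷ xs) rewrite count-∷ p x xs | count-∷ q x xs =
    +-mono-≤ (iverson-mono (p⊆q x)) (count-mono p⊆q xs)

  count-< : ∀ {p q : A → Bool} → (∀ x → p x ≡ true → q x ≡ true) →
            ∀ {y xs} → y ∈ xs → p y ≡ false → q y ≡ true → count p xs < count q xs
  count-< {p} {q} p⊆q {xs = y ∷ xs} (here refl) py qy
    rewrite count-∷ p y xs | count-∷ q y xs | py | qy = s≤s (count-mono p⊆q xs)
  count-< {p} {q} p⊆q {xs = x ∷ xs} (there y∈xs) py qy
    rewrite count-∷ p x xs | count-∷ q x xs = +-mono-≤-< (iverson-mono (p⊆q x)) (count-< p⊆q y∈xs py qy)

  count-pos : ∀ {p : A → Bool} {y xs} → y ∈ xs → p y ≡ true → 0 < count p xs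
  count-pos {p} {xs = y ∷ xs} (here refl) py rewrite count-∷ p y xs | py = s≤s z≤n
  count-pos {p} {xs = x ∷ xs} (there y∈xs) py rewrite count-∷ p x xs = ≤-trans (count-pos y∈xs py) (m≤n+m _ _)

  count-∨-∧ : ∀ (p q : A → Bool) xs →
              count (λ x → p x ∨ q x) xs + count (λ x → p x ∧ q x) xs ≡ count p xs + count q xs
  count-∨-∧ p q [] = refl
  count-∨-∧ p q (x ∷ xs) = begin
    count p∨q (x ∷ xs) + count p∧q (x ∷ xs)
      ≡⟨ cong₂ _+_ (count-∷ p∨q x xs) (count-∷ p∧q x xs) ⟩
    (iverson (p x ∨ q x) + count p∨q xs) + (iverson (p x ∧ q x) + count p∧q xs)
      ≡⟨ interchange (iverson (p x ∨ q x)) (count p∨q xs) (iverson (p x ∧ q x)) (count p∧q xs) ⟩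
    (iverson (p x ∨ q x) + iverson (p x ∧ q x)) + (count p∨q xs + count p∧q xs)
      ≡⟨ cong₂ _+_ (iverson-∨-∧ (p x) (q x)) (count-∨-∧ p q xs) ⟩
    (iverson (p x) + iverson (q x)) + (count p xs + count q xs)
      ≡⟨ interchange (iverson (p x)) (iverson (q x)) (count p xs) (count q xs) ⟩
    (iverson (p x) + count p xs) + (iverson (q x) + count q xs)
      ≡⟨ sym (cong₂ _+_ (count-∷ p x xs) (count-∷ q x xs)) ⟩
    count p (x ∷ xs) + count q (x ∷ xs) ∎
    where
    open ≡-Reasoning
    p∨q p∧q : A → Bool
    p∨q y = p y ∨ q y
    p∧q y = p y ∧ q y
    iverson-∨-∧ : ∀ a b → iverson (a ∨ b) + iverson (a ∧ b) ≡ iverson a + iverson b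
    iverson-∨-∧ true true = refl
    iverson-∨-∧ true false = refl
    iverson-∨-∧ false true = refl
    iverson-∨-∧ false false = refl

  count-∨ : ∀ (p q : A → Bool) xs → count (λ x → p x ∨ q x) xs ≤ count p xs + count q xs
  count-∨ p q xs = ≤-trans (m≤m+n _ _) (≤-reflexive (count-∨-∧ p q xs))

  count-≤-length : ∀ (p : A → Bool) xs → count p xs ≤ length xs
  count-≤-length p = length-filter (λ x → p x ≟B true)

  count-witness : ∀ {p : A → Bool} xs → 0 < count p xs → ∃ λ x → p x ≡ true
  count-witness {p} xs 0<count with filter (λ x → p x ≟B true) xs in eq
  ... | x ∷ _ = x , proj₂ (∈-filter⁻ (λ y → p y ≟B true) {xs = xs} (subst (x ∈_) (sym eq) (here refl)))

  count-≤1 : ∀ {p : A → Bool} {xs} → Unique xs → (∀ {x y} → p x ≡ true → p y ≡ true → x ≡ y) → count p xs ≤ 1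
  count-≤1 {p} {xs} unique p-single = length-≤1 (filter⁺ (λ x → p x ≟B true) unique) all-equal
    where
    all-equal : ∀ {x y} → x ∈ filter (λ x → p x ≟B true) xs → y ∈ filter (λ x → p x ≟B true) xs → x ≡ y
    all-equal x∈ y∈ = p-single (proj₂ (∈-filter⁻ (λ x → p x ≟B true) {xs = xs} x∈))
                                (proj₂ (∈-filter⁻ (λ x → p x ≟B true) {xs = xs} y∈))
    length-≤1 : ∀ {ys : List A} → Unique ys → (∀ {x y} → x ∈ ys → y ∈ ys → x ≡ y) → length ys ≤ 1
    length-≤1 [] _ = z≤n
    length-≤1 (_ ∷ []) _ = s≤s z≤n
    length-≤1 ((x≢y ∷ _) ∷ _) same = ⊥-elim (x≢y (same (here refl) (there (here refl))))

concatMap-unique : ∀ {A B : Set} (key : B → A) {f : A → List B} {xs} → Unique xs → (∀ x → Unique (f x)) →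
                   (∀ {x y} → y ∈ f x → key y ≡ x) → Unique (concatMap f xs)
concatMap-unique key [] _ _ = []
concatMap-unique key {f} {x ∷ xs} (x∉xs ∷ xs-unique) f-unique keyed =
  ++⁺ (f-unique x) (concatMap-unique key xs-unique f-unique keyed) disjoint
  where
  disjoint : Disjoint (f x) (concatMap f xs)
  disjoint (y∈fx , y∈rest) =
    All¬⇒¬Any x∉xs (Any.map (λ y∈fz → trans (sym (keyed y∈fx)) (keyed y∈fz)) (∈-concatMap⁻ f y∈rest))

-- Edges and edge sets

module _ {n : ℕ} where

  edge-≡ : {f g : Edge n} → lo f ≡ lo g → hi f ≡ hi g → f ≡ g
  edge-≡ {edge a b a<b} {edge .a .b a<b′} refl refl = cong (edge a b) (<-irrelevant a<b a<b′)

  ==E-refl : (f : Edge n) → (f ==E f) ≡ true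
  ==E-refl f = ∧-true⁺ (dec-true (lo f ≟F lo f) refl) (dec-true (hi f ≟F hi f) refl)

  ==E⁻ : {f g : Edge n} → (f ==E g) ≡ true → f ≡ g
  ==E⁻ {f} {g} eq with ∧-true⁻ eq
  ... | lo≡ , hi≡ = edge-≡ (does-true⁻ (lo f ≟F lo g) lo≡) (does-true⁻ (hi f ≟F hi g) hi≡)

  ==E-≢ : {f g : Edge n} → f ≢ g → (f ==E g) ≡ false
  ==E-≢ {f} {g} f≢g with f ==E g in eq
  ... | true = ⊥-elim (f≢g (==E⁻ eq))
  ... | false = refl

  _≟E_ : (f g : Edge n) → Dec (f ≡ g)
  f ≟E g with f ==E g in f==g
  ... | true = yes (==E⁻ f==g)
  ... | false = no (λ { refl → not-¬ f==g (==E-refl f) })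

  data Joins (f : Edge n) (a b : Fin n) : Set where
    forwards  : lo f ≡ a → hi f ≡ b → Joins f a b
    backwards : lo f ≡ b → hi f ≡ a → Joins f a b

  lo≢hi : (f : Edge n) → lo f ≢ hi f
  lo≢hi f lo≡hi = <-irrefl lo≡hi (lo<hi f)

  Joins⇒≢ : ∀ {f a b} → Joins f a b → a ≢ b
  Joins⇒≢ {f} (forwards refl refl) = lo≢hi f
  Joins⇒≢ {f} (backwards refl refl) = lo≢hi f ∘ sym

  Joins-unique : ∀ {f g a b} → Joins f a b → Joins g a b → f ≡ g
  Joins-unique (forwards p q) (forwards r s) = edge-≡ (trans p (sym r)) (trans q (sym s))
  Joins-unique (backwards p q) (backwards r s) = edge-≡ (trans p (sym r)) (trans q (sym s))
  Joins-unique {f} {g} (forwards refl refl) (backwards r s) =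
    ⊥-elim (<-asym (lo<hi f) (subst₂ _<F_ r s (lo<hi g)))
  Joins-unique {f} {g} (backwards refl refl) (forwards r s) =
    ⊥-elim (<-asym (lo<hi f) (subst₂ _<F_ r s (lo<hi g)))

  mkEdge-Joins : ∀ a b (a≢b : a ≢ b) → Joins (mkEdge a b a≢b) a b
  mkEdge-Joins a b a≢b with <-cmp a b
  ... | tri< _ _ _ = forwards refl refl
  ... | tri≈ _ a≡b _ = ⊥-elim (a≢b a≡b)
  ... | tri> _ _ _ = backwards refl refl

  Joins-endpoint : ∀ {f a b c d} → Joins f a b → Joins f c d → c ≡ a ⊎ c ≡ b
  Joins-endpoint (forwards refl refl) (forwards c≡ _) = inj₁ (sym c≡)
  Joins-endpoint (forwards refl refl) (backwards _ c≡) = inj₂ (sym c≡)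
  Joins-endpoint (backwards refl refl) (forwards c≡ _) = inj₂ (sym c≡)
  Joins-endpoint (backwards refl refl) (backwards _ c≡) = inj₁ (sym c≡)

  Joins-≢ : ∀ {f g a b c d} → Joins f a b → Joins g c d → c ≢ a → c ≢ b → f ≢ g
  Joins-≢ f-ab g-cd c≢a c≢b refl with Joins-endpoint f-ab g-cd
  ... | inj₁ c≡a = c≢a c≡a
  ... | inj₂ c≡b = c≢b c≡b

  at-vertex? : (x : Edge n) (v : Fin n) → (∃ λ c → Joins x v c) ⊎ (lo x ≢ v × hi x ≢ v)
  at-vertex? x v with lo x ≟F v | hi x ≟F v
  ... | yes lo≡v | _ = inj₁ (hi x , forwards lo≡v refl)
  ... | no _ | yes hi≡v = inj₁ (lo x , backwards refl hi≡v)
  ... | no lo≢v | no hi≢v = inj₂ (lo≢v , hi≢v)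

  off-endpoint : ∀ {u w} (u≢w : u ≢ w) {x} → x ≢ mkEdge u w u≢w → ∃ λ c → (lo x ≡ c ⊎ hi x ≡ c) × c ≢ u × c ≢ w
  off-endpoint {u = u} {w = w} u≢w {x} x≢uw with lo x ≟F u | lo x ≟F w | hi x ≟F u | hi x ≟F w
  ... | no lo≢u | no lo≢w | _ | _ = lo x , inj₁ refl , lo≢u , lo≢w
  ... | _ | _ | no hi≢u | no hi≢w = hi x , inj₂ refl , hi≢u , hi≢w
  ... | yes lo≡u | _ | yes hi≡u | _ = ⊥-elim (lo≢hi x (trans lo≡u (sym hi≡u)))
  ... | _ | yes lo≡w | _ | yes hi≡w = ⊥-elim (lo≢hi x (trans lo≡w (sym hi≡w)))
  ... | yes lo≡u | _ | no _ | yes hi≡w = ⊥-elim (x≢uw (Joins-unique (forwards lo≡u hi≡w) (mkEdge-Joins u w u≢w)))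
  ... | no _ | yes lo≡w | yes hi≡u | _ = ⊥-elim (x≢uw (Joins-unique (backwards lo≡w hi≡u) (mkEdge-Joins u w u≢w)))

-- allEdges is defined with a local function that cannot be named here, so it is recovered by unification.
private
  allEdges-by-pairs : ∀ n → ∃ λ (pick : Fin n → Fin n → List (Edge n)) →
                      allEdges n ≡ concatMap (λ i → concatMap (pick i) (allFin n)) (allFin n)
  allEdges-by-pairs n = _ , refl

module _ {n : ℕ} where

  private
    pick : Fin n → Fin n → List (Edge n)
    pick = proj₁ (allEdges-by-pairs n)

    pick-cases : ∀ i j → (Σ (i <F j) λ i<j → pick i j ≡ edge i j i<j ∷ []) ⊎ (¬ i <F j × pick i j ≡ [])
    pick-cases i j with <-cmp i j
    ... | tri< i<j _ _ = inj₁ (i<j , refl)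
    ... | tri≈ _ i≡j _ = inj₂ (<-irrefl i≡j , refl)
    ... | tri> _ _ j<i = inj₂ ((λ i<j → <-asym i<j j<i) , refl)

    ∈-pick⁻ : ∀ {i j f} → f ∈ pick i j → lo f ≡ i × hi f ≡ j
    ∈-pick⁻ {i} {j} f∈ with pick-cases i j
    ... | inj₁ (_ , eq) rewrite eq with f∈
    ...   | here refl = refl , refl
    ∈-pick⁻ {i} {j} f∈ | inj₂ (_ , eq) rewrite eq with f∈
    ...   | ()

    ∈-pick⁺ : (f : Edge n) → f ∈ pick (lo f) (hi f)
    ∈-pick⁺ f with pick-cases (lo f) (hi f)
    ... | inj₁ (_ , eq) rewrite eq = here (edge-≡ refl refl)
    ... | inj₂ (lo≮hi , _) = ⊥-elim (lo≮hi (lo<hi f))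

    pick-unique : ∀ i j → Unique (pick i j)
    pick-unique i j with pick-cases i j
    ... | inj₁ (_ , eq) rewrite eq = [] ∷ []
    ... | inj₂ (_ , eq) rewrite eq = []

  ∈-allEdges : (f : Edge n) → f ∈ allEdges n
  ∈-allEdges f = ∈-concatMap⁺ _ (lose (∈-allFin (lo f)) (∈-concatMap⁺ _ (lose (∈-allFin (hi f)) (∈-pick⁺ f))))

  allEdges-unique : Unique (allEdges n)
  allEdges-unique = concatMap-unique lo (allFin⁺ n) row-unique lo-of-row
    where
    row-unique : ∀ i → Unique (concatMap (pick i) (allFin n))
    row-unique i = concatMap-unique hi (allFin⁺ n) (pick-unique i) (proj₂ ∘ ∈-pick⁻)
    lo-of-row : ∀ {i f} → f ∈ concatMap (pick i) (allFin n) → lo f ≡ i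
    lo-of-row {i} f∈ with satisfied (∈-concatMap⁻ (pick i) {xs = allFin n} f∈)
    ... | _ , f∈pick = proj₁ (∈-pick⁻ f∈pick)

infixr 6 _∪E_
infixr 7 _∩E_
infix 4 _∉E_

_∪E_ : EdgeSet n → EdgeSet n → EdgeSet n
(S ∪E T) f = S f ∨ T f

_∩E_ : EdgeSet n → EdgeSet n → EdgeSet n
(S ∩E T) f = S f ∧ T f

_∉E_ : Edge n → EdgeSet n → Set
f ∉E S = S f ≡ false

⊆∪Eˡ : ∀ (S T : EdgeSet n) → S ⊆E (S ∪E T)
⊆∪Eˡ S T f = ∨-trueˡ {S f} (T f)

⊆∪Eʳ : ∀ (S T : EdgeSet n) → T ⊆E (S ∪E T)
⊆∪Eʳ S T f = ∨-trueʳ (S f) {T f}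

∈∪E⁻ : ∀ (S T : EdgeSet n) → f ∈E (S ∪E T) → f ∈E S ⊎ f ∈E T
∈∪E⁻ {f = f} S T = ∨-true⁻ {S f} {T f}

∈∩E⁺ : ∀ (S T : EdgeSet n) → f ∈E S → f ∈E T → f ∈E (S ∩E T)
∈∩E⁺ {f = f} S T = ∧-true⁺ {S f} {T f}

∈∩E⁻ : ∀ (S T : EdgeSet n) → f ∈E (S ∩E T) → f ∈E S × f ∈E T
∈∩E⁻ {f = f} S T = ∧-true⁻ {S f} {T f}

∈+E-here : ∀ (S : EdgeSet n) e → e ∈E (S +E e)
∈+E-here S e = ∨-trueʳ (S e) (==E-refl e)

⊆+E : ∀ (S : EdgeSet n) e → S ⊆E (S +E e)
⊆+E S e f = ∨-trueˡ {S f} (f ==E e)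

∈+E⁻ : ∀ (S : EdgeSet n) e → f ∈E (S +E e) → f ∈E S ⊎ f ≡ e
∈+E⁻ {f = f} S e f∈ with ∨-true⁻ {S f} f∈
... | inj₁ f∈S = inj₁ f∈S
... | inj₂ f==e = inj₂ (==E⁻ f==e)

∈singleton⁻ : f ∈E (∅E +E e) → f ≡ e
∈singleton⁻ {f = f} {e = e} = ==E⁻ {f = f} {g = e}

+E-⊆ : S ⊆E T → e ∈E T → (S +E e) ⊆E T
+E-⊆ {S = S} {e = e} S⊆T e∈T f f∈ with ∈+E⁻ S e f∈
... | inj₁ f∈S = S⊆T f f∈S
... | inj₂ refl = e∈T

∈-E⁺ : ∀ (S : EdgeSet n) e → f ∈E S → f ≢ e → f ∈E (S -E e)
∈-E⁺ S e f∈S f≢e rewrite f∈S | ==E-≢ f≢e = refl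

∈-E⁻ : ∀ (S : EdgeSet n) e → f ∈E (S -E e) → f ∈E S × f ≢ e
∈-E⁻ {f = f} S e f∈ with ∧-true⁻ {S f} f∈
... | f∈S , f≠e = f∈S , λ { refl → not-¬ (cong not (==E-refl e)) f≠e }

-E-⊆ : ∀ (S : EdgeSet n) e → (S -E e) ⊆E S
-E-⊆ S e f f∈ = proj₁ (∈-E⁻ S e f∈)

∉-E-here : ∀ (S : EdgeSet n) e → e ∉E (S -E e)
∉-E-here S e rewrite ==E-refl e with S e
... | true = refl
... | false = refl

∈E-or-∉E : ∀ (S : EdgeSet n) f → f ∈E S ⊎ f ∉E S
∈E-or-∉E S f with S f
... | true = inj₁ refl
... | false = inj₂ refl

∈∉⇒≢ : f ∈E S → g ∉E S → f ≢ g
∈∉⇒≢ f∈S g∉S refl = not-¬ g∉S f∈S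

card-mono : S ⊆E T → card S ≤ card T
card-mono {S = S} {T = T} S⊆T = count-mono {p = S} {T} S⊆T (allEdges _)

card-< : S ⊆E T → e ∉E S → e ∈E T → card S < card T
card-< {S = S} {T = T} {e = e} S⊆T = count-< {p = S} {T} S⊆T (∈-allEdges e)

card-∪-∩ : ∀ (S T : EdgeSet n) → card (S ∪E T) + card (S ∩E T) ≡ card S + card T
card-∪-∩ S T = count-∨-∧ S T (allEdges _)

card-∪ : ∀ (S T : EdgeSet n) → card (S ∪E T) ≤ card S + card T
card-∪ S T = count-∨ S T (allEdges _)

card-pos : e ∈E S → 0 < card S
card-pos {e = e} {S = S} = count-pos {p = S} (∈-allEdges e)

card-witness : 0 < card S → ∃ λ e → e ∈E S
card-witness {S = S} = count-witness {p = S} (allEdges _)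

card-≤1 : (∀ {f g} → f ∈E S → g ∈E S → f ≡ g) → card S ≤ 1
card-≤1 {S = S} = count-≤1 {p = S} allEdges-unique

card-+E : ∀ (S : EdgeSet n) e → card (S +E e) ≤ suc (card S)
card-+E S e = begin
  card (S ∪E (∅E +E e)) ≤⟨ card-∪ S (∅E +E e) ⟩
  card S + card (∅E +E e) ≤⟨ +-monoʳ-≤ (card S) (card-≤1 {S = ∅E +E e} (λ f∈ g∈ → trans (∈singleton⁻ {e = e} f∈) (sym (∈singleton⁻ {e = e} g∈)))) ⟩
  card S + 1 ≡⟨ +-comm (card S) 1 ⟩
  suc (card S) ∎
  where open ≤-Reasoning

+E-mono : S ⊆E T → (S +E e) ⊆E (T +E e)
+E-mono {S = S} {T = T} {e = e} S⊆T f f∈ with ∈+E⁻ S e f∈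
... | inj₁ f∈S = ⊆+E T e f (S⊆T f f∈S)
... | inj₂ refl = ∈+E-here T e

⊆-E+E : ∀ (S : EdgeSet n) e → S ⊆E ((S -E e) +E e)
⊆-E+E S e f f∈S with f ≟E e
... | yes refl = ∈+E-here (S -E e) e
... | no f≢e = ⊆+E (S -E e) e f (∈-E⁺ S e f∈S f≢e)

card-−E : e ∈E S → card (S -E e) < card S
card-−E {e = e} {S = S} e∈S = card-< {S = S -E e} {e = e} (-E-⊆ S e) (∉-E-here S e) e∈S

card-≤-−E : ∀ (S : EdgeSet n) e → card S ≤ suc (card (S -E e))
card-≤-−E S e = ≤-trans (card-mono (⊆-E+E S e)) (card-+E (S -E e) e)

member-other-than : 2 ≤ card S → ∀ e → ∃ λ f → f ∈E S × f ≢ e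
member-other-than {S = S} 2≤card e with card-witness {S = S -E e} (s≤s⁻¹ (≤-trans 2≤card (card-≤-−E S e)))
... | f , f∈ = f , ∈-E⁻ S e f∈

⊆-all-but-one : I ⊆E S → card S ≤ suc (card I) → e ∈E S → e ∉E I → (S -E e) ⊆E I
⊆-all-but-one {I = I} {S = S} {e = e} I⊆S card-S≤ e∈S e∉I f f∈ with ∈E-or-∉E I f
... | inj₁ f∈I = f∈I
... | inj₂ f∉I = ⊥-elim (1+n≰n (≤-trans (≤-trans (s≤s I<S-e) (card-−E {S = S} e∈S)) card-S≤))
  where
  I⊆S-e : I ⊆E (S -E e)
  I⊆S-e g g∈I = ∈-E⁺ S e (I⊆S g g∈I) (∈∉⇒≢ {S = I} g∈I e∉I)
  I<S-e : card I < card (S -E e)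
  I<S-e = card-< {S = I} {e = f} I⊆S-e f∉I f∈

∉+E : f ∉E S → f ≢ e → f ∉E (S +E e)
∉+E {f = f} {S = S} {e = e} f∉S f≢e rewrite f∉S = ==E-≢ f≢e

fullE : EdgeSet n
fullE _ = true

∪E-⊆ : S ⊆E I → T ⊆E I → (S ∪E T) ⊆E I
∪E-⊆ {S = S} {T = T} S⊆I T⊆I f f∈ = [ S⊆I f , T⊆I f ]′ (∈∪E⁻ S T f∈)

∪E-mono : S ⊆E I → T ⊆E J → (S ∪E T) ⊆E (I ∪E J)
∪E-mono {S = S} {I = I} {T = T} {J = J} S⊆I T⊆J f f∈ with ∈∪E⁻ S T f∈
... | inj₁ f∈S = ⊆∪Eˡ I J f (S⊆I f f∈S)
... | inj₂ f∈T = ⊆∪Eʳ I J f (T⊆J f f∈T)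

⊇-by-card : I ⊆E S → card S ≤ card I → S ⊆E I
⊇-by-card {I = I} I⊆S S≤I f f∈S with ∈E-or-∉E I f
... | inj₁ f∈I = f∈I
... | inj₂ f∉I = ⊥-elim (1+n≰n (≤-trans (card-< {S = I} {e = f} I⊆S f∉I f∈S) S≤I))

-- Vertex sets

VSet : ℕ → Set
VSet n = Fin n → Bool

private
  variable
    U W W₁ W₂ : VSet n

infix 4 _∈ᵥ_ _∉ᵥ_

_∈ᵥ_ : Fin n → VSet n → Set
v ∈ᵥ U = U v ≡ true

_∉ᵥ_ : Fin n → VSet n → Set
v ∉ᵥ U = U v ≡ false

cardᵥ : VSet n → ℕ
cardᵥ {n} U = count U (allFin n)

K[_] : VSet n → EdgeSet n
K[ U ] f = U (lo f) ∧ U (hi f)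

｛_｝ᵥ : Fin n → VSet n
｛ u ｝ᵥ v = does (v ≟F u)

∈K⁻ : f ∈E K[ U ] → lo f ∈ᵥ U × hi f ∈ᵥ U
∈K⁻ {f = f} {U = U} = ∧-true⁻ {U (lo f)}

Joins-∈K : Joins f a b → a ∈ᵥ U → b ∈ᵥ U → f ∈E K[ U ]
Joins-∈K (forwards refl refl) a∈U b∈U = ∧-true⁺ a∈U b∈U
Joins-∈K (backwards refl refl) a∈U b∈U = ∧-true⁺ b∈U a∈U

Joins-∈ᵥ : Joins f a b → f ∈E K[ U ] → a ∈ᵥ U × b ∈ᵥ U
Joins-∈ᵥ {f = f} {U = U} (forwards refl refl) f∈ = ∈K⁻ {f = f} {U = U} f∈
Joins-∈ᵥ {f = f} {U = U} (backwards refl refl) f∈ = swap (∈K⁻ {f = f} {U = U} f∈)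

∈｛｝ᵥ : ∀ (u : Fin n) → u ∈ᵥ ｛ u ｝ᵥ
∈｛｝ᵥ u = dec-true (u ≟F u) refl

∈｛｝ᵥ⁻ : v ∈ᵥ ｛ u ｝ᵥ → v ≡ u
∈｛｝ᵥ⁻ {v = v} {u = u} = does-true⁻ (v ≟F u)

cardᵥ-≤ : (U : VSet n) → cardᵥ U ≤ n
cardᵥ-≤ {n} U = subst (cardᵥ U ≤_) (length-tabulate (λ i → i)) (count-≤-length U (allFin n))

cardᵥ-｛｝ : (u : Fin n) → cardᵥ ｛ u ｝ᵥ ≤ 1
cardᵥ-｛｝ {n} u = count-≤1 {p = ｛ u ｝ᵥ} (allFin⁺ n) (λ v∈ w∈ → trans (∈｛｝ᵥ⁻ v∈) (sym (∈｛｝ᵥ⁻ w∈)))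

_∪ᵥ_ _∩ᵥ_ : VSet n → VSet n → VSet n
(U ∪ᵥ W) v = U v ∨ W v
(U ∩ᵥ W) v = U v ∧ W v

∈∩ᵥ⁻ : v ∈ᵥ (U ∩ᵥ W) → v ∈ᵥ U × v ∈ᵥ W
∈∩ᵥ⁻ {v = v} {U = U} = ∧-true⁻ {U v}

pairᵥ : Fin n → Fin n → VSet n
pairᵥ u w = ｛ u ｝ᵥ ∪ᵥ ｛ w ｝ᵥ

∈pairᵥ⁺ : v ≡ u ⊎ v ≡ w → v ∈ᵥ pairᵥ u w
∈pairᵥ⁺ {u = u} (inj₁ refl) = ∨-trueˡ _ (∈｛｝ᵥ u)
∈pairᵥ⁺ {u = u} {w = w} (inj₂ refl) = ∨-trueʳ (｛ u ｝ᵥ w) (∈｛｝ᵥ w)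

∈pairᵥ⁻ : v ∈ᵥ pairᵥ u w → v ≡ u ⊎ v ≡ w
∈pairᵥ⁻ {v = v} {u = u} v∈ with ∨-true⁻ {｛ u ｝ᵥ v} v∈
... | inj₁ v∈｛u｝ = inj₁ (∈｛｝ᵥ⁻ v∈｛u｝)
... | inj₂ v∈｛w｝ = inj₂ (∈｛｝ᵥ⁻ v∈｛w｝)

_∖ᵥ_ : VSet n → Fin n → VSet n
(U ∖ᵥ v) x = U x ∧ not (does (x ≟F v))

∈∖ᵥ⁺ : u ∈ᵥ U → u ≢ v → u ∈ᵥ (U ∖ᵥ v)
∈∖ᵥ⁺ {u = u} {v = v} u∈U u≢v rewrite u∈U | dec-false (u ≟F v) u≢v = refl

∈∖ᵥ⁻ : u ∈ᵥ (U ∖ᵥ v) → u ∈ᵥ U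
∈∖ᵥ⁻ {u = u} {U = U} = proj₁ ∘ ∧-true⁻ {U u}

∉∖ᵥ-here : ∀ (U : VSet n) v → v ∉ᵥ (U ∖ᵥ v)
∉∖ᵥ-here U v rewrite dec-true (v ≟F v) refl with U v
... | true = refl
... | false = refl

cardᵥ-∖ᵥ : v ∈ᵥ U → cardᵥ (U ∖ᵥ v) < cardᵥ U
cardᵥ-∖ᵥ {v = v} {U = U} v∈U =
  count-< {p = U ∖ᵥ v} {U} (λ _ → ∈∖ᵥ⁻ {U = U}) (∈-allFin v) (∉∖ᵥ-here U v) v∈U

cardᵥ-≥2 : u ≢ w → u ∈ᵥ U → w ∈ᵥ U → 2 ≤ cardᵥ U
cardᵥ-≥2 {u = u} {w = w} {U = U} u≢w u∈U w∈U = ≤-trans (s≤s (count-pos {p = ｛ u ｝ᵥ} (∈-allFin u) (∈｛｝ᵥ u)))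
  (count-< {p = ｛ u ｝ᵥ} {U} (λ v v∈ → subst (_∈ᵥ U) (sym (∈｛｝ᵥ⁻ v∈)) u∈U) (∈-allFin w) (dec-false (w ≟F u) (u≢w ∘ sym)) w∈U)

_∈V?_ : (v : Fin n) (S : EdgeSet n) → Dec (v ∈V S)
_∈V?_ {n} v S = map′ satisfied (λ (f , f∈S) → lose (∈-allEdges f) f∈S)
  (Any.any? (λ f → (S f ≟B true) ×-dec ((lo f ≟F v) ⊎-dec (hi f ≟F v))) (allEdges n))

∈ᵥ-or-∉ᵥ : ∀ (U : VSet n) v → v ∈ᵥ U ⊎ v ∉ᵥ U
∈ᵥ-or-∉ᵥ U v with U v
... | true = inj₁ refl
... | false = inj₂ refl

record Separation (W₁ W₂ : VSet n) (u w : Fin n) : Set where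
  field
    covers : ∀ v → v ∈ᵥ W₁ ⊎ v ∈ᵥ W₂
    meets  : ∀ {v} → v ∈ᵥ W₁ → v ∈ᵥ W₂ → v ≡ u ⊎ v ≡ w
    u∈W₁   : u ∈ᵥ W₁
    w∈W₁   : w ∈ᵥ W₁
    u∈W₂   : u ∈ᵥ W₂
    w∈W₂   : w ∈ᵥ W₂

  ∉W₁⇒∈W₂ : v ∉ᵥ W₁ → v ∈ᵥ W₂
  ∉W₁⇒∈W₂ {v = v} v∉W₁ with covers v
  ... | inj₁ v∈W₁ = ⊥-elim (not-¬ v∉W₁ v∈W₁)
  ... | inj₂ v∈W₂ = v∈W₂

  CrossEdge : Edge n → Set
  CrossEdge x = ∃ λ p → ∃ λ q → Joins x p q × p ∈ᵥ W₁ × p ∉ᵥ W₂ × q ∈ᵥ W₂ × q ∉ᵥ W₁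

  edge-cases : ∀ x → x ∈E K[ W₁ ] ⊎ x ∈E K[ W₂ ] ⊎ CrossEdge x
  edge-cases x with ∈ᵥ-or-∉ᵥ W₁ (lo x) | ∈ᵥ-or-∉ᵥ W₁ (hi x)
  ... | inj₁ lo∈W₁ | inj₁ hi∈W₁ = inj₁ (∧-true⁺ lo∈W₁ hi∈W₁)
  ... | inj₂ lo∉W₁ | inj₂ hi∉W₁ = inj₂ (inj₁ (∧-true⁺ (∉W₁⇒∈W₂ lo∉W₁) (∉W₁⇒∈W₂ hi∉W₁)))
  ... | inj₁ lo∈W₁ | inj₂ hi∉W₁ with ∈ᵥ-or-∉ᵥ W₂ (lo x)
  ...   | inj₁ lo∈W₂ = inj₂ (inj₁ (∧-true⁺ lo∈W₂ (∉W₁⇒∈W₂ hi∉W₁)))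
  ...   | inj₂ lo∉W₂ = inj₂ (inj₂ (lo x , hi x , forwards refl refl , lo∈W₁ , lo∉W₂ , ∉W₁⇒∈W₂ hi∉W₁ , hi∉W₁))
  edge-cases x | inj₂ lo∉W₁ | inj₁ hi∈W₁ with ∈ᵥ-or-∉ᵥ W₂ (hi x)
  ...   | inj₁ hi∈W₂ = inj₂ (inj₁ (∧-true⁺ (∉W₁⇒∈W₂ lo∉W₁) hi∈W₂))
  ...   | inj₂ hi∉W₂ = inj₂ (inj₂ (hi x , lo x , backwards refl refl , hi∈W₁ , hi∉W₂ , ∉W₁⇒∈W₂ lo∉W₁ , lo∉W₁))

  cardᵥ-sum : cardᵥ W₁ + cardᵥ W₂ ≤ n + 2
  cardᵥ-sum = begin
    cardᵥ W₁ + cardᵥ W₂                  ≡⟨ sym (count-∨-∧ W₁ W₂ (allFin n)) ⟩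
    cardᵥ (W₁ ∪ᵥ W₂) + cardᵥ (W₁ ∩ᵥ W₂)  ≤⟨ +-mono-≤ (cardᵥ-≤ (W₁ ∪ᵥ W₂)) W₁∩W₂-small ⟩
    n + 2                                ∎
    where
    open ≤-Reasoning
    W₁∩W₂-small : cardᵥ (W₁ ∩ᵥ W₂) ≤ 2
    W₁∩W₂-small = begin
      cardᵥ (W₁ ∩ᵥ W₂)               ≤⟨ count-mono (λ v v∈ → ∈pairᵥ⁺ (uncurry meets (∈∩ᵥ⁻ {U = W₁} {W = W₂} v∈))) (allFin n) ⟩
      cardᵥ (pairᵥ u w)              ≤⟨ count-∨ ｛ u ｝ᵥ ｛ w ｝ᵥ (allFin n) ⟩
      cardᵥ ｛ u ｝ᵥ + cardᵥ ｛ w ｝ᵥ  ≤⟨ +-mono-≤ (cardᵥ-｛｝ u) (cardᵥ-｛｝ w) ⟩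
      2                              ∎

-- Matroids

¬¬-decidable-Vec : ∀ k (P : Vec Bool k → Set) → ¬ ¬ (∀ bs → Dec (P bs))
¬¬-decidable-Vec zero P = ¬¬-map (λ P[]? → λ { [] → P[]? }) ¬¬-excluded-middle
¬¬-decidable-Vec (suc k) P = do
  P-true? ← ¬¬-decidable-Vec k (P ∘ (true ∷_))
  P-false? ← ¬¬-decidable-Vec k (P ∘ (false ∷_))
  return λ { (true ∷ bs) → P-true? bs ; (false ∷ bs) → P-false? bs }
  where open RawMonad ¬¬-Monad

module _ {n : ℕ} where

  private
    select : (L : List (Edge n)) → Vec Bool (length L) → EdgeSet n
    select [] [] f = false
    select (x ∷ L) (b ∷ bs) f = (b ∧ (f ==E x)) ∨ select L bs f

    restrict : (L : List (Edge n)) → EdgeSet n → Vec Bool (length L)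
    restrict [] S = []
    restrict (x ∷ L) S = S x ∷ restrict L S

    select-restrict-⊆ : ∀ L (S : EdgeSet n) → select L (restrict L S) ⊆E S
    select-restrict-⊆ (x ∷ L) S f f∈ with ∨-true⁻ {S x ∧ (f ==E x)} f∈
    ... | inj₁ here∈ with ∧-true⁻ {S x} here∈
    ...   | x∈S , f==x rewrite ==E⁻ {f = f} {g = x} f==x = x∈S
    select-restrict-⊆ (x ∷ L) S f f∈ | inj₂ there∈ = select-restrict-⊆ L S f there∈

    ⊆-select-restrict : ∀ L (S : EdgeSet n) f → f ∈ L → f ∈E S → f ∈E select L (restrict L S)
    ⊆-select-restrict (x ∷ L) S f (here refl) f∈S rewrite f∈S | ==E-refl f = refl
    ⊆-select-restrict (x ∷ L) S f (there f∈L) f∈S = ∨-trueʳ (S x ∧ (f ==E x)) (⊆-select-restrict L S f f∈L f∈S)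

  ¬¬-decidable : (P : EdgeSet n → Set) → (∀ {S T} → S ⊆E T → T ⊆E S → P S → P T) → ¬ ¬ (∀ S → Dec (P S))
  ¬¬-decidable P P-resp = ¬¬-map decide (¬¬-decidable-Vec (length (allEdges n)) (P ∘ select (allEdges n)))
    where
    decide : (∀ bs → Dec (P (select (allEdges n) bs))) → ∀ S → Dec (P S)
    decide P? S = map′ (P-resp ⊆S S⊆) (P-resp S⊆ ⊆S) (P? (restrict (allEdges n) S))
      where
      ⊆S : select (allEdges n) (restrict (allEdges n) S) ⊆E S
      ⊆S = select-restrict-⊆ (allEdges n) S
      S⊆ : S ⊆E select (allEdges n) (restrict (allEdges n) S)
      S⊆ f = ⊆-select-restrict (allEdges n) S f (∈-allEdges f)

module MatroidTheory {n : ℕ} (M : Matroid n) where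

  open Matroid M

  infix 4 _spans_

  -- For independent B: S lies in the closure of B.
  _spans_ : EdgeSet n → EdgeSet n → Set
  B spans S = ∀ f → f ∈E S → Indep (B +E f) → f ∈E B

  indep-⊂-circuit : Circuit C → e ∈E C → S ⊆E C → e ∉E S → Indep S
  indep-⊂-circuit {C = C} {S = S} (_ , C-minimal) e∈C S⊆C e∉S =
    indep-⊆ (C-minimal _ e∈C) (λ f f∈S → ∈-E⁺ C _ (S⊆C f f∈S) (∈∉⇒≢ {S = S} f∈S e∉S))

  private
    augment-with-fuel : ∀ k → Indep I → Indep J → card J ≤ card I + k →
                        ∃ λ B → Indep B × I ⊆E B × B ⊆E (I ∪E J) × card J ≤ card B
    augment-with-fuel {I = I} {J = J} k I-indep J-indep J≤I+k with card J ≤? card I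
    ... | yes J≤I = I , I-indep , (λ _ f∈ → f∈) , ⊆∪Eˡ I J , J≤I
    augment-with-fuel zero I-indep J-indep J≤I+0 | no J≰I =
      contradiction (subst (_ ≤_) (+-identityʳ _) J≤I+0) J≰I
    augment-with-fuel {I = I} {J = J} (suc k) I-indep J-indep J≤I+1+k | no J≰I
      with augment I-indep J-indep (≰⇒> J≰I)
    ... | z , z∈J , z∉I , I+z-indep with augment-with-fuel k I+z-indep J-indep J≤I+z+k
      where
      J≤I+z+k : card J ≤ card (I +E z) + k
      J≤I+z+k = ≤-trans J≤I+1+k (≤-trans (≤-reflexive (+-suc (card I) k))
                  (+-monoˡ-≤ k (card-< {S = I} {e = z} (⊆+E I z) z∉I (∈+E-here I z))))
    ...   | B , B-indep , I+z⊆B , B⊆ , J≤B = B , B-indep , (λ f f∈I → I+z⊆B f (⊆+E I z f f∈I)) , B⊆I∪J , J≤B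
      where
      B⊆I∪J : B ⊆E (I ∪E J)
      B⊆I∪J f f∈B with ∈∪E⁻ (I +E z) J (B⊆ f f∈B)
      ... | inj₂ f∈J = ⊆∪Eʳ I J f f∈J
      ... | inj₁ f∈I+z with ∈+E⁻ I z f∈I+z
      ...   | inj₁ f∈I = ⊆∪Eˡ I J f f∈I
      ...   | inj₂ refl = ⊆∪Eʳ I J z z∈J

  record Augmentation (I J : EdgeSet n) : Set where
    field
      A       : EdgeSet n
      A-indep : Indep A
      I⊆A     : I ⊆E A
      A⊆I∪J   : A ⊆E (I ∪E J)
      J≤A     : card J ≤ card A

  augment-to-size : Indep I → Indep J → Augmentation I J
  augment-to-size {J = J} I-indep J-indep with augment-with-fuel (card J) I-indep J-indep (m≤n+m _ _)
  ... | A , A-indep , I⊆A , A⊆I∪J , J≤A = record { A = A ; A-indep = A-indep ; I⊆A = I⊆A ; A⊆I∪J = A⊆I∪J ; J≤A = J≤A }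

  circuit-exchange : Circuit C → Indep J → card C ≤ card J → e ∈E C →
                     ∃ λ z → z ∈E J × z ∉E C × Indep ((C -E e) +E z)
  circuit-exchange {C = C} {e = e} (C-dep , C-minimal) J-indep C≤J e∈C
    with augment (C-minimal e e∈C) J-indep (<-≤-trans (card-−E {S = C} e∈C) C≤J)
  ... | z , z∈J , z∉C-e , C-e+z-indep with ∈E-or-∉E C z
  ...   | inj₂ z∉C = z , z∈J , z∉C , C-e+z-indep
  ...   | inj₁ z∈C = ⊥-elim (C-dep (indep-⊆ C-e+z-indep (subst (λ x → C ⊆E ((C -E e) +E x)) (sym z≡e) (⊆-E+E C e))))
    where
    z≡e : z ≡ e
    z≡e with z ≟E e
    ... | yes z≡e = z≡e
    ... | no z≢e = ⊥-elim (not-¬ z∉C-e (∈-E⁺ C e z∈C z≢e))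

  spans-card : Indep B → B spans S → Indep I → I ⊆E S → card I ≤ card B
  spans-card {B = B} {I = I} B-indep B-spans I-indep I⊆S with card I ≤? card B
  ... | yes I≤B = I≤B
  ... | no I≰B with augment B-indep I-indep (≰⇒> I≰B)
  ...   | f , f∈I , f∉B , B+f-indep = ⊥-elim (not-¬ f∉B (B-spans f (I⊆S f f∈I) B+f-indep))

  circuit-minus-spans : Circuit C → e ∈E C → (C -E e) spans C
  circuit-minus-spans {C = C} {e = e} (C-dep , _) e∈C f f∈C C-e+f-indep with f ≟E e
  ... | yes refl = ⊥-elim (C-dep (indep-⊆ C-e+f-indep (⊆-E+E C e)))
  ... | no f≢e = ∈-E⁺ C e f∈C f≢e

  module WithDecidableIndep (indep? : ∀ S → Dec (Indep S)) where

    private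
      greedy : ∀ L → Indep I → I ⊆E S →
               ∃ λ B → Indep B × I ⊆E B × B ⊆E S × (∀ f → f ∈ L → f ∈E S → Indep (B +E f) → f ∈E B)
      greedy [] I-indep I⊆S = _ , I-indep , (λ _ f∈ → f∈) , I⊆S , λ _ ()
      greedy {S = S} (x ∷ L) I-indep I⊆S with greedy L I-indep I⊆S
      ... | B , B-indep , I⊆B , B⊆S , B-max with ∈E-or-∉E S x | indep? (B +E x)
      ...   | inj₁ x∈S | yes B+x-indep =
        B +E x , B+x-indep , (λ f f∈I → ⊆+E B x f (I⊆B f f∈I)) , +E-⊆ B⊆S x∈S , B+x-max
        where
        B+x-max : ∀ f → f ∈ x ∷ L → f ∈E S → Indep ((B +E x) +E f) → f ∈E (B +E x)
        B+x-max f (here refl) _ _ = ∈+E-here B x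
        B+x-max f (there f∈L) f∈S indep =
          ⊆+E B x f (B-max f f∈L f∈S (indep-⊆ indep (+E-mono {S = B} {T = B +E x} {e = f} (⊆+E B x))))
      ...   | inj₁ x∈S | no B+x-dep = B , B-indep , I⊆B , B⊆S , B-max′
        where
        B-max′ : ∀ f → f ∈ x ∷ L → f ∈E S → Indep (B +E f) → f ∈E B
        B-max′ f (here refl) _ B+x-indep = ⊥-elim (B+x-dep B+x-indep)
        B-max′ f (there f∈L) = B-max f f∈L
      ...   | inj₂ x∉S | _ = B , B-indep , I⊆B , B⊆S , B-max′
        where
        B-max′ : ∀ f → f ∈ x ∷ L → f ∈E S → Indep (B +E f) → f ∈E B
        B-max′ f (here refl) x∈S _ = ⊥-elim (not-¬ x∉S x∈S)
        B-max′ f (there f∈L) = B-max f f∈L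

    extend-to-basis : Indep I → I ⊆E S → ∃ λ B → Indep B × I ⊆E B × B ⊆E S × B spans S
    extend-to-basis I-indep I⊆S with greedy (allEdges n) I-indep I⊆S
    ... | B , B-indep , I⊆B , B⊆S , B-max = B , B-indep , I⊆B , B⊆S , λ f → B-max f (∈-allEdges f)

    spans-trans : Indep B → Indep P → B spans P → P spans S → B spans S
    spans-trans {B = B} {P = P} B-indep P-indep B-spans-P P-spans-S x x∈S B+x-indep with ∈E-or-∉E B x
    ... | inj₁ x∈B = x∈B
    ... | inj₂ x∉B with extend-to-basis P-indep (⊆∪Eʳ B P)
    ...   | Q , Q-indep , P⊆Q , Q⊆B∪P , Q-spans-B∪P = ⊥-elim (1+n≰n (begin
            suc (card B)   ≤⟨ card-< {S = B} {e = x} (⊆+E B x) x∉B (∈+E-here B x) ⟩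
            card (B +E x)  ≤⟨ spans-card Q-indep Q-spans-B∪P+x B+x-indep (+E-mono {e = x} (⊆∪Eˡ B P)) ⟩
            card Q         ≤⟨ spans-card B-indep B-spans-B∪P Q-indep Q⊆B∪P ⟩
            card B         ∎))
      where
      open ≤-Reasoning
      B-spans-B∪P : B spans (B ∪E P)
      B-spans-B∪P f f∈ B+f-indep with ∈∪E⁻ B P f∈
      ... | inj₁ f∈B = f∈B
      ... | inj₂ f∈P = B-spans-P f f∈P B+f-indep
      Q-spans-B∪P+x : Q spans ((B ∪E P) +E x)
      Q-spans-B∪P+x f f∈ Q+f-indep with ∈+E⁻ (B ∪E P) x f∈
      ... | inj₁ f∈B∪P = Q-spans-B∪P f f∈B∪P Q+f-indep
      ... | inj₂ refl = Q-spans-B∪P x x∈B∪P Q+f-indep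
        where
        x∈B∪P : x ∈E (B ∪E P)
        x∈B∪P = ⊆∪Eʳ B P x (P-spans-S x x∈S (indep-⊆ Q+f-indep (+E-mono {e = x} P⊆Q)))

    spans-∪ : Indep Q → Indep B₁ → Indep B₂ → Q spans (B₁ ∪E B₂) → B₁ spans S → B₂ spans T → Q spans (S ∪E T)
    spans-∪ {B₁ = B₁} {B₂ = B₂} {S = S} {T = T} Q-indep B₁-indep B₂-indep Q-spans B₁-spans B₂-spans x x∈ =
      [ spans-trans Q-indep B₁-indep (λ f f∈ → Q-spans f (⊆∪Eˡ B₁ B₂ f f∈)) B₁-spans x
      , spans-trans Q-indep B₂-indep (λ f f∈ → Q-spans f (⊆∪Eʳ B₁ B₂ f f∈)) B₂-spans x
      ]′ (∈∪E⁻ S T x∈)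

    spans-via-circuit : Indep B → Circuit C → e ∈E C → B spans (C -E e) → B spans C
    spans-via-circuit B-indep C-circuit@(_ , C-minimal) e∈C B-spans =
      spans-trans B-indep (C-minimal _ e∈C) B-spans (circuit-minus-spans C-circuit e∈C)

-- 2-rigidity matroids

Among3 : Fin n → Fin n → Fin n → Fin n → Set
Among3 b c d v = v ≡ b ⊎ v ≡ c ⊎ v ≡ d

Among3-∈ᵥ : b ∈ᵥ W → c ∈ᵥ W → d ∈ᵥ W → Among3 b c d v → v ∈ᵥ W
Among3-∈ᵥ b∈W _ _ (inj₁ refl) = b∈W
Among3-∈ᵥ _ c∈W _ (inj₂ (inj₁ refl)) = c∈W
Among3-∈ᵥ _ _ d∈W (inj₂ (inj₂ refl)) = d∈W

K4-vertices : Fin n → Fin n → Fin n → Fin n → VSet n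
K4-vertices a b c d v = does (v ≟F a) ∨ does (v ≟F b) ∨ does (v ≟F c) ∨ does (v ≟F d)

K4-vertices⁻ : v ∈ᵥ K4-vertices a b c d → v ≡ a ⊎ Among3 b c d v
K4-vertices⁻ {v = v} {a = a} {b = b} {c = c} {d = d} v∈ with ∨-true⁻ {does (v ≟F a)} v∈
... | inj₁ v≡a = inj₁ (does-true⁻ (v ≟F a) v≡a)
... | inj₂ v∈bcd with ∨-true⁻ {does (v ≟F b)} v∈bcd
...   | inj₁ v≡b = inj₂ (inj₁ (does-true⁻ (v ≟F b) v≡b))
...   | inj₂ v∈cd with ∨-true⁻ {does (v ≟F c)} v∈cd
...     | inj₁ v≡c = inj₂ (inj₂ (inj₁ (does-true⁻ (v ≟F c) v≡c)))
...     | inj₂ v≡d = inj₂ (inj₂ (inj₂ (does-true⁻ (v ≟F d) v≡d)))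

K4-vertices⁺ : v ≡ a ⊎ Among3 b c d v → v ∈ᵥ K4-vertices a b c d
K4-vertices⁺ {a = a} (inj₁ refl) = ∨-trueˡ _ (dec-true (a ≟F a) refl)
K4-vertices⁺ {v = v} {a = a} {b = b} (inj₂ (inj₁ refl)) =
  ∨-trueʳ (does (v ≟F a)) (∨-trueˡ _ (dec-true (b ≟F b) refl))
K4-vertices⁺ {v = v} {a = a} {b = b} {c = c} (inj₂ (inj₂ (inj₁ refl))) =
  ∨-trueʳ (does (v ≟F a)) (∨-trueʳ (does (v ≟F b)) (∨-trueˡ _ (dec-true (c ≟F c) refl)))
K4-vertices⁺ {v = v} {a = a} {b = b} {c = c} {d = d} (inj₂ (inj₂ (inj₂ refl))) =
  ∨-trueʳ (does (v ≟F a)) (∨-trueʳ (does (v ≟F b)) (∨-trueʳ (does (v ≟F c)) (dec-true (d ≟F d) refl)))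

-- K4 a b c d unfolds to K[ K4-vertices a b c d ].
Joins-∈K4 : Joins f x y → x ≡ a ⊎ Among3 b c d x → y ≡ a ⊎ Among3 b c d y → f ∈E K4 a b c d
Joins-∈K4 f-xy x∈ y∈ =
  Joins-∈K f-xy (K4-vertices⁺ x∈) (K4-vertices⁺ y∈)

private
  K4-edge-from-a : ∀ {x} → Joins f a b → g ≢ f → Joins g a x → Among3 b c d x → Joins g a c ⊎ Joins g a d
  K4-edge-from-a f-ab g≢f g-ab (inj₁ refl) = ⊥-elim (g≢f (Joins-unique g-ab f-ab))
  K4-edge-from-a _ _ g-ac (inj₂ (inj₁ refl)) = inj₁ g-ac
  K4-edge-from-a _ _ g-ad (inj₂ (inj₂ refl)) = inj₂ g-ad

K4-edge-cases : Joins f a b → g ∈E K4 a b c d → g ≢ f →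
                Joins g a c ⊎ Joins g a d ⊎ (∀ {W} → b ∈ᵥ W → c ∈ᵥ W → d ∈ᵥ W → g ∈E K[ W ])
K4-edge-cases {f = f} {a = a} {b = b} {g = g} {c = c} {d = d} f-ab g∈K4 g≢f
  with ∈K⁻ {f = g} {U = K4-vertices a b c d} g∈K4
... | lo∈ , hi∈ with K4-vertices⁻ {v = lo g} lo∈ | K4-vertices⁻ {v = hi g} hi∈
...   | inj₁ lo≡a | inj₁ hi≡a = ⊥-elim (lo≢hi g (trans lo≡a (sym hi≡a)))
...   | inj₁ lo≡a | inj₂ hi∈bcd = map₂ inj₁ (K4-edge-from-a f-ab g≢f (forwards lo≡a refl) hi∈bcd)
...   | inj₂ lo∈bcd | inj₁ hi≡a = map₂ inj₁ (K4-edge-from-a f-ab g≢f (backwards refl hi≡a) lo∈bcd)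
...   | inj₂ lo∈bcd | inj₂ hi∈bcd =
  inj₂ (inj₂ λ b∈W c∈W d∈W → ∧-true⁺ (Among3-∈ᵥ b∈W c∈W d∈W lo∈bcd) (Among3-∈ᵥ b∈W c∈W d∈W hi∈bcd))

K4-minus-⊆ : Joins f a b → (∀ {g} → Joins g a c → g ∈E T) → (∀ {g} → Joins g a d → g ∈E T) →
             K[ W ] ⊆E T → b ∈ᵥ W → c ∈ᵥ W → d ∈ᵥ W → (K4 a b c d -E f) ⊆E T
K4-minus-⊆ {f = f} {a = a} {b = b} {c = c} {d = d} f-ab ac∈T ad∈T KW⊆T b∈W c∈W d∈W g g∈
  with ∈-E⁻ {f = g} (K4 a b c d) f g∈
... | g∈K4 , g≢f with K4-edge-cases {c = c} {d = d} f-ab g∈K4 g≢f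
...   | inj₁ g-ac = ac∈T g-ac
...   | inj₂ (inj₁ g-ad) = ad∈T g-ad
...   | inj₂ (inj₂ g∈K[W]) = KW⊆T g (g∈K[W] b∈W c∈W d∈W)

private
  glue-arithmetic : ∀ {c c₁ c₂ a₁ a₂ r} n → c + 1 ≤ c₁ + c₂ → c₁ + 3 ≤ 2 * a₁ → c₂ + 3 ≤ 2 * a₂ →
                    a₁ + a₂ ≤ n + 2 → r + 3 ≡ 2 * n → c ≤ r
  glue-arithmetic {c} {c₁} {c₂} {a₁} {a₂} {r} n c+1≤ c₁-bound c₂-bound a₁+a₂≤ r+3≡2n = +-cancelʳ-≤ 7 c r (begin
    c + 7                   ≡⟨ sym (+-assoc c 1 6) ⟩
    (c + 1) + 6             ≤⟨ +-monoˡ-≤ 6 c+1≤ ⟩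
    (c₁ + c₂) + (3 + 3)     ≡⟨ interchange c₁ c₂ 3 3 ⟩
    (c₁ + 3) + (c₂ + 3)     ≤⟨ +-mono-≤ c₁-bound c₂-bound ⟩
    2 * a₁ + 2 * a₂         ≡⟨ sym (*-distribˡ-+ 2 a₁ a₂) ⟩
    2 * (a₁ + a₂)           ≤⟨ *-monoʳ-≤ 2 a₁+a₂≤ ⟩
    2 * (n + 2)             ≡⟨ *-distribˡ-+ 2 n 2 ⟩
    2 * n + 4               ≡⟨ cong (_+ 4) (sym r+3≡2n) ⟩
    (r + 3) + 4             ≡⟨ +-assoc r 3 4 ⟩
    r + 7                   ∎)
    where open ≤-Reasoning

module Rigidity {n : ℕ} (R : RigidityMatroid2 n) where

  open RigidityMatroid2 R
  open MatroidTheory matroid hiding (module WithDecidableIndep)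

  edge-indep : Joins e a b → c ≢ a → c ≢ b → d ≢ a → d ≢ b → c ≢ d → Indep (∅E +E e)
  edge-indep {e = e} {a = a} {b = b} {c = c} {d = d} e-ab c≢a c≢b d≢a d≢b c≢d =
    indep-⊂-circuit {e = mkEdge c d c≢d} (K4-circ c d a b c≢d c≢a c≢b d≢a d≢b (Joins⇒≢ e-ab)) cd∈K4 e⊆K4 cd∉e
    where
    cd-cd : Joins (mkEdge c d c≢d) c d
    cd-cd = mkEdge-Joins c d c≢d
    cd∈K4 : mkEdge c d c≢d ∈E K4 c d a b
    cd∈K4 = Joins-∈K4 cd-cd (inj₁ refl) (inj₂ (inj₁ refl))
    e⊆K4 : (∅E +E e) ⊆E K4 c d a b
    e⊆K4 f f∈ with refl ← ∈singleton⁻ {f = f} {e = e} f∈ =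
      Joins-∈K4 e-ab (inj₂ (inj₂ (inj₁ refl))) (inj₂ (inj₂ (inj₂ refl)))
    cd∉e : mkEdge c d c≢d ∉E (∅E +E e)
    cd∉e = ==E-≢ (Joins-≢ e-ab cd-cd c≢a c≢b ∘ sym)

  module WithDecidableIndep (indep? : ∀ S → Dec (Indep S)) where

    open MatroidTheory.WithDecidableIndep matroid indep?

    spans-K4-edge : Indep B → Joins f a b → a ≢ c → a ≢ d → b ≢ c → b ≢ d → c ≢ d →
                    B spans (K4 a b c d -E f) → Indep (B +E f) → f ∈E B
    spans-K4-edge {f = f} {a = a} {b = b} {c = c} {d = d} B-indep f-ab a≢c a≢d b≢c b≢d c≢d B-spans =
      spans-via-circuit {e = f} B-indep (K4-circ a b c d (Joins⇒≢ f-ab) a≢c a≢d b≢c b≢d c≢d) f∈K4 B-spans f f∈K4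
      where
      f∈K4 : f ∈E K4 a b c d
      f∈K4 = Joins-∈K4 f-ab (inj₁ refl) (inj₂ (inj₁ refl))

    spans-K-from-K∖ᵥ : (v≢u : v ≢ u) (v≢w : v ≢ w) → u ≢ w → u ∈ᵥ (U ∖ᵥ v) → w ∈ᵥ (U ∖ᵥ v) → Indep B →
                        B spans ((K[ U ∖ᵥ v ] +E mkEdge v u v≢u) +E mkEdge v w v≢w) → B spans K[ U ]
    spans-K-from-K∖ᵥ {v = v} {u = u} {w = w} {U = U} {B = B} v≢u v≢w u≢w u∈ w∈ B-indep B-spans x x∈K[U] =
      spans-edge (at-vertex? x v)
      where
      vu vw : Edge n
      vu = mkEdge v u v≢u
      vw = mkEdge v w v≢w
      K[U∖v] T₀ : EdgeSet n
      K[U∖v] = K[ U ∖ᵥ v ]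
      T₀ = K[U∖v] +E vu
      vu∈T : ∀ {g} → Joins g v u → g ∈E (T₀ +E vw)
      vu∈T g-vu rewrite Joins-unique g-vu (mkEdge-Joins v u v≢u) = ⊆+E T₀ vw vu (∈+E-here K[U∖v] vu)
      vw∈T : ∀ {g} → Joins g v w → g ∈E (T₀ +E vw)
      vw∈T g-vw rewrite Joins-unique g-vw (mkEdge-Joins v w v≢w) = ∈+E-here T₀ vw
      K[U∖v]⊆T : K[U∖v] ⊆E (T₀ +E vw)
      K[U∖v]⊆T g g∈ = ⊆+E T₀ vw g (⊆+E K[U∖v] vu g g∈)

      spans-edge : (∃ λ c → Joins x v c) ⊎ (lo x ≢ v × hi x ≢ v) → Indep (B +E x) → x ∈E B
      spans-edge (inj₂ (lo≢v , hi≢v)) = B-spans x (K[U∖v]⊆T x x∈K[U∖v])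
        where
        x∈K[U∖v] : x ∈E K[U∖v]
        x∈K[U∖v] = ∧-true⁺ (∈∖ᵥ⁺ {U = U} (proj₁ (∈K⁻ {f = x} {U = U} x∈K[U])) lo≢v)
                           (∈∖ᵥ⁺ {U = U} (proj₂ (∈K⁻ {f = x} {U = U} x∈K[U])) hi≢v)
      spans-edge (inj₁ (c , x-vc)) with c ≟F u | c ≟F w
      ... | yes refl | _ = B-spans x (vu∈T x-vc)
      ... | no _ | yes refl = B-spans x (vw∈T x-vc)
      ... | no c≢u | no c≢w =
        spans-K4-edge B-indep x-vc v≢u v≢w c≢u c≢w u≢w
          (λ g g∈ → B-spans g (K4-minus-⊆ x-vc vu∈T vw∈T K[U∖v]⊆T c∈ u∈ w∈ g g∈))
        where
        c∈ : c ∈ᵥ (U ∖ᵥ v)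
        c∈ = ∈∖ᵥ⁺ {U = U} (proj₂ (Joins-∈ᵥ {U = U} x-vc x∈K[U])) (Joins⇒≢ x-vc ∘ sym)

    HasSmallBasis : VSet n → Set
    HasSmallBasis U = ∃ λ B → Indep B × B spans K[ U ] × card B + 3 ≤ 2 * cardᵥ U

    private
      two-vertex-basis : u ≢ w → u ∈ᵥ U → w ∈ᵥ U → (∀ v → v ∈ᵥ U → v ≡ u ⊎ v ≡ w) → HasSmallBasis U
      two-vertex-basis {u = u} {w = w} {U = U} u≢w u∈U w∈U only-u-w
        with extend-to-basis {S = K[ U ]} indep-∅ (λ _ ())
      ... | B , B-indep , _ , B⊆K , B-spans = B , B-indep , B-spans , (begin
            card B + 3     ≤⟨ +-monoˡ-≤ 3 (card-≤1 {S = B} λ f∈ g∈ → Joins-unique (joins-u-w (B⊆K _ f∈)) (joins-u-w (B⊆K _ g∈))) ⟩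
            2 * 2          ≤⟨ *-monoʳ-≤ 2 (cardᵥ-≥2 u≢w u∈U w∈U) ⟩
            2 * cardᵥ U    ∎)
        where
        open ≤-Reasoning
        joins-u-w : f ∈E K[ U ] → Joins f u w
        joins-u-w {f = f} f∈ with only-u-w (lo f) (proj₁ (∈K⁻ {f = f} {U = U} f∈)) | only-u-w (hi f) (proj₂ (∈K⁻ {f = f} {U = U} f∈))
        ... | inj₁ lo≡u | inj₂ hi≡w = forwards lo≡u hi≡w
        ... | inj₂ lo≡w | inj₁ hi≡u = backwards lo≡w hi≡u
        ... | inj₁ lo≡u | inj₁ hi≡u = ⊥-elim (lo≢hi f (trans lo≡u (sym hi≡u)))
        ... | inj₂ lo≡w | inj₂ hi≡w = ⊥-elim (lo≢hi f (trans lo≡w (sym hi≡w)))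

      step-arithmetic : ∀ {b b′ m m′} → b ≤ suc (suc b′) → b′ + 3 ≤ 2 * m′ → m′ < m → b + 3 ≤ 2 * m
      step-arithmetic {b} {b′} {m} {m′} b≤ b′-bound m′<m = begin
        b + 3              ≤⟨ +-monoˡ-≤ 3 b≤ ⟩
        suc (suc (b′ + 3)) ≤⟨ s≤s (s≤s b′-bound) ⟩
        2 + 2 * m′         ≡⟨ sym (*-suc 2 m′) ⟩
        2 * suc m′         ≤⟨ *-monoʳ-≤ 2 m′<m ⟩
        2 * m              ∎
        where open ≤-Reasoning

      add-vertex : (v≢u : v ≢ u) (v≢w : v ≢ w) → u ≢ w → u ∈ᵥ (U ∖ᵥ v) → w ∈ᵥ (U ∖ᵥ v) → v ∈ᵥ U →
                   HasSmallBasis (U ∖ᵥ v) → HasSmallBasis U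
      add-vertex {v = v} {u = u} {w = w} {U = U} v≢u v≢w u≢w u∈ w∈ v∈U (B′ , B′-indep , B′-spans , B′-bound)
        with extend-to-basis {S = (B′ +E mkEdge v u v≢u) +E mkEdge v w v≢w} indep-∅ (λ _ ())
      ... | B , B-indep , _ , B⊆ , B-spans =
        B , B-indep , spans-K-from-K∖ᵥ v≢u v≢w u≢w u∈ w∈ B-indep B-spans-star , step-arithmetic B-small B′-bound (cardᵥ-∖ᵥ {U = U} v∈U)
        where
        vu vw : Edge n
        vu = mkEdge v u v≢u
        vw = mkEdge v w v≢w
        B-spans-B′ : B spans B′
        B-spans-B′ f f∈B′ = B-spans f (⊆+E (B′ +E vu) vw f (⊆+E B′ vu f f∈B′))
        B-spans-star : B spans ((K[ U ∖ᵥ v ] +E vu) +E vw)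
        B-spans-star x x∈ with ∈+E⁻ {f = x} (K[ U ∖ᵥ v ] +E vu) vw x∈
        ... | inj₂ refl = B-spans x (∈+E-here (B′ +E vu) vw)
        ... | inj₁ x∈′ with ∈+E⁻ {f = x} K[ U ∖ᵥ v ] vu x∈′
        ...   | inj₂ refl = B-spans x (⊆+E (B′ +E vu) vw vu (∈+E-here B′ vu))
        ...   | inj₁ x∈K = spans-trans B-indep B′-indep B-spans-B′ B′-spans x x∈K
        B-small : card B ≤ suc (suc (card B′))
        B-small = ≤-trans (card-mono B⊆) (≤-trans (card-+E (B′ +E vu) vw) (s≤s (card-+E B′ vu)))

      small-basis-with-fuel : ∀ k → cardᵥ U ≤ k → u ≢ w → u ∈ᵥ U → w ∈ᵥ U → HasSmallBasis U
      small-basis-with-fuel {U = U} {u = u} {w = w} k U≤k u≢w u∈U w∈U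
        with any? (λ v → (U v ≟B true) ×-dec ¬? (v ≟F u) ×-dec ¬? (v ≟F w))
      ... | no no-third-vertex = two-vertex-basis u≢w u∈U w∈U only-u-w
        where
        only-u-w : ∀ v → v ∈ᵥ U → v ≡ u ⊎ v ≡ w
        only-u-w v v∈U with v ≟F u | v ≟F w
        ... | yes v≡u | _ = inj₁ v≡u
        ... | no _ | yes v≡w = inj₂ v≡w
        ... | no v≢u | no v≢w = ⊥-elim (no-third-vertex (v , v∈U , v≢u , v≢w))
      small-basis-with-fuel {U = U} zero U≤0 _ u∈U _ | yes _ =
        ⊥-elim (1+n≰n (≤-trans (count-pos {p = U} (∈-allFin _) u∈U) U≤0))
      small-basis-with-fuel {U = U} {u = u} {w = w} (suc k) U≤1+k u≢w u∈U w∈U | yes (v , v∈U , v≢u , v≢w) =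
        add-vertex v≢u v≢w u≢w u∈U∖v w∈U∖v v∈U
          (small-basis-with-fuel k (s≤s⁻¹ (≤-trans (cardᵥ-∖ᵥ {U = U} v∈U) U≤1+k)) u≢w u∈U∖v w∈U∖v)
        where
        u∈U∖v : u ∈ᵥ (U ∖ᵥ v)
        u∈U∖v = ∈∖ᵥ⁺ {U = U} u∈U (v≢u ∘ sym)
        w∈U∖v : w ∈ᵥ (U ∖ᵥ v)
        w∈U∖v = ∈∖ᵥ⁺ {U = U} w∈U (v≢w ∘ sym)

    rank-bound : u ≢ w → u ∈ᵥ U → w ∈ᵥ U → Indep I → I ⊆E K[ U ] → card I + 3 ≤ 2 * cardᵥ U
    rank-bound {U = U} u≢w u∈U w∈U I-indep I⊆K with small-basis-with-fuel (cardᵥ U) ≤-refl u≢w u∈U w∈U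
    ... | B , B-indep , B-spans , B-bound = ≤-trans (+-monoˡ-≤ 3 (spans-card B-indep B-spans I-indep I⊆K)) B-bound

    spans-across : u ≢ w → Separation W₁ W₂ u w → Indep Q → Q spans (K[ W₁ ] ∪E K[ W₂ ]) → Q spans fullE
    spans-across {u = u} {w = w} {W₁ = W₁} {W₂ = W₂} {Q = Q} u≢w sep Q-indep Q-spans x _
      with Separation.edge-cases sep x
    ... | inj₁ x∈K[W₁] = Q-spans x (⊆∪Eˡ K[ W₁ ] K[ W₂ ] x x∈K[W₁])
    ... | inj₂ (inj₁ x∈K[W₂]) = Q-spans x (⊆∪Eʳ K[ W₁ ] K[ W₂ ] x x∈K[W₂])
    ... | inj₂ (inj₂ (p , q , x-pq , p∈W₁ , p∉W₂ , q∈W₂ , q∉W₁)) =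
      spans-K4-edge Q-indep x-pq p≢u p≢w q≢u q≢w u≢w
        (λ g g∈ → Q-spans g (K4-minus-⊆ x-pq p-u∈ p-w∈ (⊆∪Eʳ K[ W₁ ] K[ W₂ ]) q∈W₂ u∈W₂ w∈W₂ g g∈))
      where
      open Separation sep
      p≢u : p ≢ u
      p≢u refl = not-¬ p∉W₂ u∈W₂
      p≢w : p ≢ w
      p≢w refl = not-¬ p∉W₂ w∈W₂
      q≢u : q ≢ u
      q≢u refl = not-¬ q∉W₁ u∈W₁
      q≢w : q ≢ w
      q≢w refl = not-¬ q∉W₁ w∈W₁
      p-u∈ : ∀ {g} → Joins g p u → g ∈E (K[ W₁ ] ∪E K[ W₂ ])
      p-u∈ {g} g-pu = ⊆∪Eˡ K[ W₁ ] K[ W₂ ] g (Joins-∈K g-pu p∈W₁ u∈W₁)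
      p-w∈ : ∀ {g} → Joins g p w → g ∈E (K[ W₁ ] ∪E K[ W₂ ])
      p-w∈ {g} g-pw = ⊆∪Eˡ K[ W₁ ] K[ W₂ ] g (Joins-∈K g-pw p∈W₁ w∈W₁)

    glue-indep : u ≢ w → Separation W₁ W₂ u w → Indep I → Indep J → I ⊆E K[ W₁ ] → J ⊆E K[ W₂ ] →
                 e ∈E I → e ∈E J → Indep (I ∪E J)
    glue-indep {u = u} {w = w} {W₁ = W₁} {W₂ = W₂} {I = I} {J = J} {e = e}
               u≢w sep I-indep J-indep I⊆K[W₁] J⊆K[W₂] e∈I e∈J
      with rank | extend-to-basis I-indep I⊆K[W₁] | extend-to-basis J-indep J⊆K[W₂]
    ... | r , ((I₀ , I₀-indep , I₀≡r) , _) , r+3≡2n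
        | B₁ , B₁-indep , I⊆B₁ , B₁⊆K[W₁] , B₁-spans | B₂ , B₂-indep , J⊆B₂ , B₂⊆K[W₂] , B₂-spans
      with extend-to-basis {S = B₁ ∪E B₂} indep-∅ (λ _ ())
    ... | Q , Q-indep , _ , Q⊆B₁∪B₂ , Q-spans =
      indep-⊆ Q-indep (λ f f∈ → ⊇-by-card Q⊆B₁∪B₂ (≤-trans B₁∪B₂≤r r≤Q) f (∪E-mono I⊆B₁ J⊆B₂ f f∈))
      where
      open Separation sep
      r≤Q : r ≤ card Q
      r≤Q = subst (_≤ card Q) I₀≡r (spans-card Q-indep Q-spans-all I₀-indep (λ _ _ → refl))
        where
        Q-spans-all : Q spans fullE
        Q-spans-all = spans-across u≢w sep Q-indep (spans-∪ Q-indep B₁-indep B₂-indep Q-spans B₁-spans B₂-spans)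
      B₁∪B₂≤r : card (B₁ ∪E B₂) ≤ r
      B₁∪B₂≤r = glue-arithmetic {a₁ = cardᵥ W₁} {a₂ = cardᵥ W₂} n
        (subst (card (B₁ ∪E B₂) + 1 ≤_) (card-∪-∩ B₁ B₂)
          (+-monoʳ-≤ (card (B₁ ∪E B₂)) (card-pos {S = B₁ ∩E B₂} (∈∩E⁺ B₁ B₂ (I⊆B₁ e e∈I) (J⊆B₂ e e∈J)))))
        (rank-bound u≢w u∈W₁ w∈W₁ B₁-indep B₁⊆K[W₁])
        (rank-bound u≢w u∈W₂ w∈W₂ B₂-indep B₂⊆K[W₂])
        cardᵥ-sum
        r+3≡2n

  glue : u ≢ w → Separation W₁ W₂ u w → Indep I → Indep J → I ⊆E K[ W₁ ] → J ⊆E K[ W₂ ] →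
         e ∈E I → e ∈E J → ¬ ¬ Indep (I ∪E J)
  glue u≢w sep I-indep J-indep I⊆ J⊆ e∈I e∈J =
    ¬¬-map (λ indep? → WithDecidableIndep.glue-indep indep? u≢w sep I-indep J-indep I⊆ J⊆ e∈I e∈J)
           (¬¬-decidable Indep (λ _ T⊆S S-indep → indep-⊆ S-indep T⊆S))

-- Circuits separated by two vertices

module TwoSeparatedCircuit {n : ℕ} (M : RigidityMatroid2 n) {G X Y : EdgeSet n} {u w : Fin n} (u≢w : u ≢ w)
  (G-circuit : RigidityMatroid2.Circuit M G) (2≤card-X : 2 ≤ card X) (2≤card-Y : 2 ≤ card Y)
  (G≡X∪Y : ∀ f → G f ≡ X f ∨ Y f) (X∩Y≡∅ : ∀ f → X f ∧ Y f ≡ false)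
  (shared-vertices : ∀ v → v ∈V X → v ∈V Y → v ≡ u ⊎ v ≡ w) where

  open RigidityMatroid2 M
  open MatroidTheory matroid
  open Rigidity M

  uw : Edge n
  uw = mkEdge u w u≢w

  X⊆G : X ⊆E G
  X⊆G f f∈X = trans (G≡X∪Y f) (⊆∪Eˡ X Y f f∈X)

  Y⊆G : Y ⊆E G
  Y⊆G f f∈Y = trans (G≡X∪Y f) (⊆∪Eʳ X Y f f∈Y)

  G⊆X∪Y : G ⊆E (X ∪E Y)
  G⊆X∪Y f f∈G = trans (sym (G≡X∪Y f)) f∈G

  X⇒∉Y : f ∈E X → f ∉E Y
  X⇒∉Y {f = f} f∈X = trans (sym (cong (_∧ Y f) f∈X)) (X∩Y≡∅ f)

  Y⇒∉X : f ∈E Y → f ∉E X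
  Y⇒∉X {f = f} f∈Y with ∈E-or-∉E X f
  ... | inj₁ f∈X = ⊥-elim (not-¬ (X⇒∉Y f∈X) f∈Y)
  ... | inj₂ f∉X = f∉X

  x₀ : Edge n
  x₀ = proj₁ (member-other-than 2≤card-X uw)

  x₀∈X : x₀ ∈E X
  x₀∈X = proj₁ (proj₂ (member-other-than 2≤card-X uw))

  x₀≢uw : x₀ ≢ uw
  x₀≢uw = proj₂ (proj₂ (member-other-than 2≤card-X uw))

  y₀ : Edge n
  y₀ = proj₁ (member-other-than 2≤card-Y uw)

  y₀∈Y : y₀ ∈E Y
  y₀∈Y = proj₁ (proj₂ (member-other-than 2≤card-Y uw))

  y₀≢uw : y₀ ≢ uw
  y₀≢uw = proj₂ (proj₂ (member-other-than 2≤card-Y uw))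

  X-indep : Indep X
  X-indep = indep-⊂-circuit G-circuit (Y⊆G y₀ y₀∈Y) X⊆G (Y⇒∉X y₀∈Y)

  Y-indep : Indep Y
  Y-indep = indep-⊂-circuit G-circuit (X⊆G x₀ x₀∈X) Y⊆G (X⇒∉Y x₀∈X)

  V[Y] : VSet n
  V[Y] v = does (v ∈V? Y)

  X-side Y-side : VSet n
  X-side v = not (V[Y] v) ∨ pairᵥ u w v
  Y-side v = V[Y] v ∨ pairᵥ u w v

  u-w-on-side : ∀ b {v} → v ≡ u ⊎ v ≡ w → (b ∨ pairᵥ u w v) ≡ true
  u-w-on-side b v∈uw = ∨-trueʳ b (∈pairᵥ⁺ v∈uw)

  separation : Separation X-side Y-side u w
  separation = record
    { covers = covers
    ; meets = meets
    ; u∈W₁ = u-w-on-side (not (V[Y] u)) (inj₁ refl)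
    ; w∈W₁ = u-w-on-side (not (V[Y] w)) (inj₂ refl)
    ; u∈W₂ = u-w-on-side (V[Y] u) (inj₁ refl)
    ; w∈W₂ = u-w-on-side (V[Y] w) (inj₂ refl)
    }
    where
    covers : ∀ v → v ∈ᵥ X-side ⊎ v ∈ᵥ Y-side
    covers v with V[Y] v
    ... | true = inj₂ refl
    ... | false = inj₁ refl
    meets : ∀ {v} → v ∈ᵥ X-side → v ∈ᵥ Y-side → v ≡ u ⊎ v ≡ w
    meets {v} v∈X-side v∈Y-side with ∨-true⁻ {not (V[Y] v)} v∈X-side | ∨-true⁻ {V[Y] v} v∈Y-side
    ... | inj₂ v∈uw | _ = ∈pairᵥ⁻ v∈uw
    ... | _ | inj₂ v∈uw = ∈pairᵥ⁻ v∈uw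
    ... | inj₁ far | inj₁ near = contradiction (subst (λ b → not b ≡ true) near far) λ ()

  X-vertex-on-X-side : v ∈V X → v ∈ᵥ X-side
  X-vertex-on-X-side {v = v} v∈V[X] with V[Y] v in near
  ... | true = u-w-on-side false (shared-vertices v v∈V[X] (does-true⁻ (v ∈V? Y) near))
  ... | false = refl

  X+uw⊆K[X-side] : (X +E uw) ⊆E K[ X-side ]
  X+uw⊆K[X-side] f f∈ with ∈+E⁻ X uw f∈
  ... | inj₁ f∈X = ∧-true⁺ (X-vertex-on-X-side (f , f∈X , inj₁ refl)) (X-vertex-on-X-side (f , f∈X , inj₂ refl))
  ... | inj₂ refl = Joins-∈K {U = X-side} (mkEdge-Joins u w u≢w) (Separation.u∈W₁ separation) (Separation.w∈W₁ separation)

  Y+uw⊆K[Y-side] : (Y +E uw) ⊆E K[ Y-side ]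
  Y+uw⊆K[Y-side] f f∈ with ∈+E⁻ Y uw f∈
  ... | inj₁ f∈Y = ∧-true⁺ (Y-vertex (f , f∈Y , inj₁ refl)) (Y-vertex (f , f∈Y , inj₂ refl))
    where
    Y-vertex : v ∈V Y → v ∈ᵥ Y-side
    Y-vertex {v = v} v∈V[Y] = ∨-trueˡ _ (dec-true (v ∈V? Y) v∈V[Y])
  ... | inj₂ refl = Joins-∈K {U = Y-side} (mkEdge-Joins u w u≢w) (Separation.u∈W₂ separation) (Separation.w∈W₂ separation)

  G-dependent : ¬ Indep G
  G-dependent = proj₁ G-circuit

  glue-sides : Indep I → Indep J → I ⊆E (X +E uw) → J ⊆E (Y +E uw) → uw ∈E I → uw ∈E J → ¬ ¬ Indep (I ∪E J)
  glue-sides I-indep J-indep I⊆ J⊆ =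
    glue u≢w separation I-indep J-indep (λ f f∈ → X+uw⊆K[X-side] f (I⊆ f f∈)) (λ f f∈ → Y+uw⊆K[Y-side] f (J⊆ f f∈))

  G⊆X+uw∪Y+uw : G ⊆E ((X +E uw) ∪E (Y +E uw))
  G⊆X+uw∪Y+uw f f∈G = ∪E-mono (⊆+E X uw) (⊆+E Y uw) f (G⊆X∪Y f f∈G)

  uw∉X : uw ∉E X
  uw∉X with ∈E-or-∉E X uw
  ... | inj₂ uw∉X = uw∉X
  ... | inj₁ uw∈X = ⊥-elim (glue-sides X-indep Y+uw-indep (⊆+E X uw) (λ _ f∈ → f∈) uw∈X (∈+E-here Y uw) X∪Y+uw-dependent)
    where
    Y+uw-indep : Indep (Y +E uw)
    Y+uw-indep = indep-⊂-circuit G-circuit (X⊆G x₀ x₀∈X) (+E-⊆ Y⊆G (X⊆G uw uw∈X)) (∉+E {S = Y} (X⇒∉Y x₀∈X) x₀≢uw)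
    X∪Y+uw-dependent : ¬ Indep (X ∪E (Y +E uw))
    X∪Y+uw-dependent indep =
      G-dependent (indep-⊆ indep (λ f f∈G → ∪E-mono {S = X} (λ _ f∈ → f∈) (⊆+E Y uw) f (G⊆X∪Y f f∈G)))

  uw-indep : Indep (∅E +E uw)
  uw-indep with off-endpoint u≢w x₀≢uw | off-endpoint u≢w y₀≢uw
  ... | c , c-end , c≢u , c≢w | d , d-end , d≢u , d≢w = edge-indep (mkEdge-Joins u w u≢w) c≢u c≢w d≢u d≢w c≢d
    where
    c≢d : c ≢ d
    c≢d refl with shared-vertices c (x₀ , x₀∈X , c-end) (y₀ , y₀∈Y , d-end)
    ... | inj₁ c≡u = c≢u c≡u
    ... | inj₂ c≡w = c≢w c≡w

  X+uw-indep⇒Y+uw-dependent : Indep (X +E uw) → ¬ Indep (Y +E uw)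
  X+uw-indep⇒Y+uw-dependent X+uw-indep Y+uw-indep =
    glue-sides X+uw-indep Y+uw-indep (λ _ f∈ → f∈) (λ _ f∈ → f∈) (∈+E-here X uw) (∈+E-here Y uw)
      (λ indep → G-dependent (indep-⊆ indep G⊆X+uw∪Y+uw))

  large-indep⇒Y+uw-indep : Indep J → J ⊆E (G +E uw) → card G ≤ card J → Indep (Y +E uw)
  large-indep⇒Y+uw-indep {J = J} J-indep J⊆G+uw G≤J =
    let z , z∈J , z∉G , G-x₀+z-indep = circuit-exchange G-circuit J-indep G≤J (X⊆G x₀ x₀∈X)
    in indep-⊆ G-x₀+z-indep (subst (λ y → (Y +E uw) ⊆E ((G -E x₀) +E y)) (sym (z≡uw z∈J z∉G)) Y+uw⊆G-x₀+uw)
    where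
    z≡uw : f ∈E J → f ∉E G → f ≡ uw
    z≡uw {f = f} f∈J f∉G = [ (λ f∈G → ⊥-elim (not-¬ f∉G f∈G)) , id ]′ (∈+E⁻ G uw (J⊆G+uw f f∈J))
    Y+uw⊆G-x₀+uw : (Y +E uw) ⊆E ((G -E x₀) +E uw)
    Y+uw⊆G-x₀+uw = +E-mono {e = uw} (λ f f∈Y → ∈-E⁺ G x₀ (Y⊆G f f∈Y) (∈∉⇒≢ {S = Y} f∈Y (X⇒∉Y x₀∈X)))

  X+uw-dependent : uw ∉E G → ¬ Indep (X +E uw)
  X+uw-dependent uw∉G X+uw-indep =
    glue-sides X+uw-indep A-indep (λ _ f∈ → f∈) A⊆Y+uw (∈+E-here X uw) (I⊆A uw (∈+E-here ∅E uw))
      (λ indep → X+uw-indep⇒Y+uw-dependent X+uw-indep (large-indep⇒Y+uw-indep indep X+uw∪A⊆G+uw card-G≤))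
    where
    open Augmentation (augment-to-size uw-indep Y-indep)

    A⊆Y+uw : A ⊆E (Y +E uw)
    A⊆Y+uw f f∈A = [ (λ f∈uw → subst (_∈E (Y +E uw)) (sym (∈singleton⁻ {e = uw} f∈uw)) (∈+E-here Y uw))
                   , ⊆+E Y uw f
                   ]′ (∈∪E⁻ (∅E +E uw) Y (A⊆I∪J f f∈A))

    X+uw∪A⊆G+uw : ((X +E uw) ∪E A) ⊆E (G +E uw)
    X+uw∪A⊆G+uw = ∪E-⊆ (+E-mono {e = uw} X⊆G) (λ f f∈A → +E-mono {e = uw} Y⊆G f (A⊆Y+uw f f∈A))

    only-uw-in-both : f ∈E ((X +E uw) ∩E A) → f ≡ uw
    only-uw-in-both {f = f} f∈ =
      cases (∈+E⁻ X uw (proj₁ (∈∩E⁻ (X +E uw) A f∈))) (∈+E⁻ Y uw (A⊆Y+uw f (proj₂ (∈∩E⁻ (X +E uw) A f∈))))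
      where
      cases : f ∈E X ⊎ f ≡ uw → f ∈E Y ⊎ f ≡ uw → f ≡ uw
      cases (inj₂ f≡uw) _ = f≡uw
      cases (inj₁ _) (inj₂ f≡uw) = f≡uw
      cases (inj₁ f∈X) (inj₁ f∈Y) = ⊥-elim (not-¬ (X⇒∉Y f∈X) f∈Y)

    card-G≤ : card G ≤ card ((X +E uw) ∪E A)
    card-G≤ = s≤s⁻¹ (begin
      suc (card G)                                   ≤⟨ s≤s (≤-trans (card-mono G⊆X∪Y) (card-∪ X Y)) ⟩
      suc (card X) + card Y                          ≤⟨ +-mono-≤ (card-< {S = X} (⊆+E X uw) uw∉X (∈+E-here X uw)) J≤A ⟩
      card (X +E uw) + card A                        ≡⟨ sym (card-∪-∩ (X +E uw) A) ⟩
      card ((X +E uw) ∪E A) + card ((X +E uw) ∩E A)  ≤⟨ +-monoʳ-≤ (card ((X +E uw) ∪E A)) (card-≤1 {S = (X +E uw) ∩E A}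
                                                          λ f∈ g∈ → trans (only-uw-in-both f∈) (sym (only-uw-in-both g∈))) ⟩
      card ((X +E uw) ∪E A) + 1                      ≡⟨ +-comm (card ((X +E uw) ∪E A)) 1 ⟩
      suc (card ((X +E uw) ∪E A))                    ∎)
      where open ≤-Reasoning

  X-edges-kept : ¬ Indep (Y +E uw) → f ∈E X → uw ∈E I → I ⊆E ((∅E +E uw) ∪E (G -E f)) → Indep I →
                 card (G -E f) ≤ card I → g ∈E X → g ≢ f → g ∈E I
  X-edges-kept {f = f} {I = I} {g = g} Y+uw-dependent f∈X uw∈I I⊆ I-indep G-f≤I g∈X g≢f =
    [ id , (λ g∉I → ⊥-elim (Y+uw-dependent (indep-⊆ I-indep (+E-⊆ (Y⊆I g∉I) uw∈I)))) ]′ (∈E-or-∉E I g)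
    where
    uw∪G-f : EdgeSet n
    uw∪G-f = (∅E +E uw) ∪E (G -E f)
    uw∪G-f≤ : card uw∪G-f ≤ suc (card I)
    uw∪G-f≤ = begin
      card uw∪G-f                       ≤⟨ card-∪ (∅E +E uw) (G -E f) ⟩
      card (∅E +E uw) + card (G -E f)   ≤⟨ +-mono-≤ (card-≤1 {S = ∅E +E uw} λ f∈ g∈ →
                                             trans (∈singleton⁻ {e = uw} f∈) (sym (∈singleton⁻ {e = uw} g∈))) G-f≤I ⟩
      suc (card I)                      ∎
      where open ≤-Reasoning
    Y⊆I : g ∉E I → Y ⊆E I
    Y⊆I g∉I y y∈Y = ⊆-all-but-one I⊆ uw∪G-f≤ (⊆∪Eʳ (∅E +E uw) (G -E f) g (∈-E⁺ G f (X⊆G g g∈X) g≢f)) g∉I y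
      (∈-E⁺ uw∪G-f g (⊆∪Eʳ (∅E +E uw) (G -E f) y (∈-E⁺ G f (Y⊆G y y∈Y) (∈∉⇒≢ {S = Y} y∈Y (X⇒∉Y f∈X))))
                    (∈∉⇒≢ {S = Y} y∈Y (X⇒∉Y g∈X)))

  X+uw-minus-indep : ¬ Indep (Y +E uw) → ∀ f → f ∈E (X +E uw) → Indep ((X +E uw) -E f)
  X+uw-minus-indep Y+uw-dependent f f∈X+uw with f ≟E uw | ∈+E⁻ X uw f∈X+uw
  ... | yes refl | _ = indep-⊆ X-indep X+uw-uw⊆X
    where
    X+uw-uw⊆X : ((X +E uw) -E uw) ⊆E X
    X+uw-uw⊆X g g∈ =
      let g∈X+uw , g≢uw = ∈-E⁻ (X +E uw) uw g∈
      in [ id , (λ g≡uw → ⊥-elim (g≢uw g≡uw)) ]′ (∈+E⁻ X uw g∈X+uw)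
  ... | no f≢uw | inj₂ f≡uw = ⊥-elim (f≢uw f≡uw)
  ... | no f≢uw | inj₁ f∈X = indep-⊆ A-indep X+uw-f⊆A
    where
    open Augmentation (augment-to-size uw-indep (proj₂ G-circuit f (X⊆G f f∈X)))
    uw∈A : uw ∈E A
    uw∈A = I⊆A uw (∈+E-here ∅E uw)
    X+uw-f⊆A : ((X +E uw) -E f) ⊆E A
    X+uw-f⊆A g g∈ =
      let g∈X+uw , g≢f = ∈-E⁻ (X +E uw) f g∈
      in [ (λ g∈X → X-edges-kept Y+uw-dependent f∈X uw∈A A⊆I∪J A-indep J≤A g∈X g≢f) , (λ { refl → uw∈A }) ]′
           (∈+E⁻ X uw g∈X+uw)


lemma5p2 : ∀ {n} (M : RigidityMatroid2 n) (G X Y : EdgeSet n) (u w : Fin n)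
    (u≢w : u ≢ w) →
    RigidityMatroid2.Circuit M G →
    2 ≤ card X → 2 ≤ card Y →
    (∀ f → G f ≡ X f ∨ Y f) → (∀ f → X f ∧ Y f ≡ false) →
    (∀ v → ((v ∈V X) × (v ∈V Y)) ⇔ (v ≡ u ⊎ v ≡ w)) →
    G (mkEdge u w u≢w) ≡ false
      × RigidityMatroid2.Circuit M (X +E mkEdge u w u≢w)
      × RigidityMatroid2.Circuit M (Y +E mkEdge u w u≢w)
lemma5p2 M G X Y u w u≢w G-circuit 2≤card-X 2≤card-Y G≡X∪Y X∩Y≡∅ shared =
  uw∉G , (XY.X+uw-dependent uw∉G , XY.X+uw-minus-indep (YX.X+uw-dependent uw∉G))
       , (YX.X+uw-dependent uw∉G , YX.X+uw-minus-indep (XY.X+uw-dependent uw∉G))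
  where
  -- Only the inclusion V(X) ∩ V(Y) ⊆ {u, w} of the last hypothesis is needed.
  shared-XY : ∀ v → v ∈V X → v ∈V Y → v ≡ u ⊎ v ≡ w
  shared-XY v v∈X v∈Y = Equivalence.to (shared v) (v∈X , v∈Y)
  shared-YX : ∀ v → v ∈V Y → v ∈V X → v ≡ u ⊎ v ≡ w
  shared-YX v v∈Y v∈X = shared-XY v v∈X v∈Y
  G≡Y∪X : ∀ f → G f ≡ Y f ∨ X f
  G≡Y∪X f = trans (G≡X∪Y f) (∨-comm (X f) (Y f))
  Y∩X≡∅ : ∀ f → Y f ∧ X f ≡ false
  Y∩X≡∅ f = trans (∧-comm (Y f) (X f)) (X∩Y≡∅ f)
  module XY = TwoSeparatedCircuit M u≢w G-circuit 2≤card-X 2≤card-Y G≡X∪Y X∩Y≡∅ shared-XY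
  module YX = TwoSeparatedCircuit M u≢w G-circuit 2≤card-Y 2≤card-X G≡Y∪X Y∩X≡∅ shared-YX
  uw∉G : G (mkEdge u w u≢w) ≡ false
  uw∉G = trans (G≡X∪Y _) (cong₂ _∨_ XY.uw∉X YX.uw∉X)
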